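{- The additive cut rule is admissible in $\mathsf{G4CK}$ and in $\mathsf{G4WK}$: for $\mathsf{S}\in\{\mathsf{G4CK},\mathsf{G4WK}\}$, for every finite multiset $\Gamma$, formula $\varphi$ and succedent $\Delta$ allowed in $\mathsf{S}$, if $\vdash_{\mathsf{S}}\Gamma\Rightarrow\varphi$ and $\vdash_{\mathsf{S}}\varphi,\Gamma\Rightarrow\Delta$, then $\vdash_{\mathsf{S}}\Gamma\Rightarrow\Delta$.
   Context: Formulas are built from a countably infinite set $\mathsf{Prop}$ of propositional variables by $\varphi ::= p \mid \bot \mid \varphi\wedge\varphi \mid \varphi\vee\varphi \mid \varphi\to\varphi \mid \Box\varphi \mid \Diamond\varphi$. For a multiset $\Gamma$, $\Box^{ -1}\Gamma=\{\varphi\mid\Box\varphi\in\Gamma\}$ and $\Diamond^{ -1}\Gamma=\{\varphi\mid\Diamond\varphi\in\Gamma\}$ (with multiplicities). A sequent is $\Gamma\Rightarrow\Delta$ with $\Gamma,\Delta$ finite multisets of formulas; $\Gamma,\varphi$ means $\Gamma\uplus\{\varphi\}$; a single formula on the right denotes a singleton. In $\mathsf{G4CK}$ succedents have exactly one element; in $\mathsf{G4WK}$ at most one. Both calculi have the rules ($p\in\mathsf{Prop}$, $\Delta$ an allowed succedent): ($\bot$L) $\Gamma,\bot\Rightarrow\Delta$ (no premises); (IdP) $\Gamma,p\Rightarrow p$ (no premises); ($\wedge$L) from $\Gamma,\varphi,\psi\Rightarrow\Delta$ infer $\Gamma,\varphi\wedge\psi\Rightarrow\Delta$; ($\wedge$R)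 from $\Gamma\Rightarrow\varphi$, $\Gamma\Rightarrow\psi$ infer $\Gamma\Rightarrow\varphi\wedge\psi$; ($\vee$L) from $\Gamma,\varphi\Rightarrow\Delta$, $\Gamma,\psi\Rightarrow\Delta$ infer $\Gamma,\varphi\vee\psi\Rightarrow\Delta$; ($\vee$R$_i$) from $\Gamma\Rightarrow\varphi_i$ infer $\Gamma\Rightarrow\varphi_1\vee\varphi_2$; ($\to$R) from $\Gamma,\varphi\Rightarrow\psi$ infer $\Gamma\Rightarrow\varphi\to\psi$; ($\wedge\!\to$L) from $\Gamma,\varphi\to(\psi\to\chi)\Rightarrow\Delta$ infer $\Gamma,(\varphi\wedge\psi)\to\chi\Rightarrow\Delta$; ($\vee\!\to$L) from $\Gamma,\varphi\to\chi,\psi\to\chi\Rightarrow\Delta$ infer $\Gamma,(\varphi\vee\psi)\to\chi\Rightarrow\Delta$; ($p\!\to$L) from $\Gamma,p,\varphi\Rightarrow\Delta$ infer $\Gamma,p,p\to\varphi\Rightarrow\Delta$; ($\to\to$L) from $\Gamma,\psi\to\chi\Rightarrow\varphi\to\psi$ and $\Gamma,\chi\Rightarrow\Delta$ infer $\Gamma,(\varphi\to\psi)\to\chi\Rightarrow\Delta$; ($\Box$R) from $\Box^{ -1}\Gamma\Rightarrow\varphi$ infer $\Gamma\Rightarrow\Box\varphi$; ($\Box\!\to$L) from $\Box^{ -1}\Gamma\Rightarrow\varphi$ and $\Gamma,\psi\Rightarrow\Delta$ infer $\Gamma,\Box\varphi\to\psi\Rightarrow\Delta$; ($\Diamond\!\to$L)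 from $\Box^{ -1}\Gamma,\gamma\Rightarrow\varphi$ and $\Gamma,\Diamond\gamma,\psi\Rightarrow\Delta$ infer $\Gamma,\Diamond\gamma,\Diamond\varphi\to\psi\Rightarrow\Delta$. Additionally $\mathsf{G4CK}$ has ($\Diamond$L): from $\Box^{ -1}\Gamma,\varphi\Rightarrow\psi$ infer $\Gamma,\Diamond\varphi\Rightarrow\Diamond\psi$; and $\mathsf{G4WK}$ instead has ($\Diamond$L$'$): from $\Box^{ -1}\Gamma,\varphi\Rightarrow\Diamond^{ -1}\Delta$ infer $\Gamma,\Diamond\varphi\Rightarrow\Delta$. $\vdash_{\mathsf{S}}\Gamma\Rightarrow\Delta$ means the sequent has a finite derivation in calculus $\mathsf{S}$. -}

module Defs where

open import Data.Nat using (ℕ)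
open import Data.List using (List; []; _∷_)
open import Data.Maybe using (Maybe; just; nothing)
open import Data.List.Relation.Binary.Permutation.Propositional using (_↭_)

Prop : Set
Prop = ℕ

infixr 6 _∧'_
infixr 5 _∨'_
infixr 4 _⇒'_

data Fm : Set where
  var  : Prop → Fm
  ⊥'   : Fm
  _∧'_ : Fm → Fm → Fm
  _∨'_ : Fm → Fm → Fm
  _⇒'_ : Fm → Fm → Fm
  □    : Fm → Fm
  ◇    : Fm → Fm

-- Finite multisets are represented by lists; a rule whose conclusion
-- antecedent is "Γ , φ₁ , … , φₖ" accepts any list that is a permutation
-- of φ₁ ∷ … ∷ φₖ ∷ Γ (so derivability only depends on the multiset).

box⁻¹ : List Fm → List Fm
box⁻¹ []          = []
box⁻¹ (□ φ ∷ Γ)   = φ ∷ box⁻¹ Γ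
box⁻¹ (_ ∷ Γ)     = box⁻¹ Γ

dia⁻¹ : Maybe Fm → Maybe Fm
dia⁻¹ (just (◇ φ)) = just φ
dia⁻¹ _            = nothing

data G4CK : List Fm → Fm → Set where
  ⊥L   : ∀ {Γ Γ' Δ} → Γ' ↭ (⊥' ∷ Γ) → G4CK Γ' Δ
  IdP  : ∀ {Γ Γ' p} → Γ' ↭ (var p ∷ Γ) → G4CK Γ' (var p)
  ∧L   : ∀ {Γ Γ' φ ψ Δ} → Γ' ↭ ((φ ∧' ψ) ∷ Γ) →
         G4CK (φ ∷ ψ ∷ Γ) Δ → G4CK Γ' Δ
  ∧R   : ∀ {Γ φ ψ} → G4CK Γ φ → G4CK Γ ψ → G4CK Γ (φ ∧' ψ)
  ∨L   : ∀ {Γ Γ' φ ψ Δ} → Γ' ↭ ((φ ∨' ψ) ∷ Γ) →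
         G4CK (φ ∷ Γ) Δ → G4CK (ψ ∷ Γ) Δ → G4CK Γ' Δ
  ∨R₁  : ∀ {Γ φ ψ} → G4CK Γ φ → G4CK Γ (φ ∨' ψ)
  ∨R₂  : ∀ {Γ φ ψ} → G4CK Γ ψ → G4CK Γ (φ ∨' ψ)
  ⇒R   : ∀ {Γ φ ψ} → G4CK (φ ∷ Γ) ψ → G4CK Γ (φ ⇒' ψ)
  ∧⇒L  : ∀ {Γ Γ' φ ψ χ Δ} → Γ' ↭ (((φ ∧' ψ) ⇒' χ) ∷ Γ) →
         G4CK ((φ ⇒' (ψ ⇒' χ)) ∷ Γ) Δ → G4CK Γ' Δ
  ∨⇒L  : ∀ {Γ Γ' φ ψ χ Δ} → Γ' ↭ (((φ ∨' ψ) ⇒' χ) ∷ Γ) →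
         G4CK ((φ ⇒' χ) ∷ (ψ ⇒' χ) ∷ Γ) Δ → G4CK Γ' Δ
  p⇒L  : ∀ {Γ Γ' p φ Δ} → Γ' ↭ (var p ∷ (var p ⇒' φ) ∷ Γ) →
         G4CK (var p ∷ φ ∷ Γ) Δ → G4CK Γ' Δ
  ⇒⇒L  : ∀ {Γ Γ' φ ψ χ Δ} → Γ' ↭ (((φ ⇒' ψ) ⇒' χ) ∷ Γ) →
         G4CK ((ψ ⇒' χ) ∷ Γ) (φ ⇒' ψ) → G4CK (χ ∷ Γ) Δ → G4CK Γ' Δ
  □R   : ∀ {Γ φ} → G4CK (box⁻¹ Γ) φ → G4CK Γ (□ φ)
  □⇒L  : ∀ {Γ Γ' φ ψ Δ} → Γ' ↭ ((□ φ ⇒' ψ) ∷ Γ) →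
         G4CK (box⁻¹ Γ) φ → G4CK (ψ ∷ Γ) Δ → G4CK Γ' Δ
  ◇⇒L  : ∀ {Γ Γ' γ φ ψ Δ} → Γ' ↭ (◇ γ ∷ (◇ φ ⇒' ψ) ∷ Γ) →
         G4CK (γ ∷ box⁻¹ Γ) φ → G4CK (◇ γ ∷ ψ ∷ Γ) Δ → G4CK Γ' Δ
  ◇L   : ∀ {Γ Γ' φ ψ} → Γ' ↭ (◇ φ ∷ Γ) →
         G4CK (φ ∷ box⁻¹ Γ) ψ → G4CK Γ' (◇ ψ)

-- G4WK : succedent has at most one formula (nothing = empty succedent)
data G4WK : List Fm → Maybe Fm → Set where
  ⊥L   : ∀ {Γ Γ' Δ} → Γ' ↭ (⊥' ∷ Γ) → G4WK Γ' Δ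
  IdP  : ∀ {Γ Γ' p} → Γ' ↭ (var p ∷ Γ) → G4WK Γ' (just (var p))
  ∧L   : ∀ {Γ Γ' φ ψ Δ} → Γ' ↭ ((φ ∧' ψ) ∷ Γ) →
         G4WK (φ ∷ ψ ∷ Γ) Δ → G4WK Γ' Δ
  ∧R   : ∀ {Γ φ ψ} → G4WK Γ (just φ) → G4WK Γ (just ψ) → G4WK Γ (just (φ ∧' ψ))
  ∨L   : ∀ {Γ Γ' φ ψ Δ} → Γ' ↭ ((φ ∨' ψ) ∷ Γ) →
         G4WK (φ ∷ Γ) Δ → G4WK (ψ ∷ Γ) Δ → G4WK Γ' Δ
  ∨R₁  : ∀ {Γ φ ψ} → G4WK Γ (just φ) → G4WK Γ (just (φ ∨' ψ))
  ∨R₂  : ∀ {Γ φ ψ} → G4WK Γ (just ψ) → G4WK Γ (just (φ ∨' ψ))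
  ⇒R   : ∀ {Γ φ ψ} → G4WK (φ ∷ Γ) (just ψ) → G4WK Γ (just (φ ⇒' ψ))
  ∧⇒L  : ∀ {Γ Γ' φ ψ χ Δ} → Γ' ↭ (((φ ∧' ψ) ⇒' χ) ∷ Γ) →
         G4WK ((φ ⇒' (ψ ⇒' χ)) ∷ Γ) Δ → G4WK Γ' Δ
  ∨⇒L  : ∀ {Γ Γ' φ ψ χ Δ} → Γ' ↭ (((φ ∨' ψ) ⇒' χ) ∷ Γ) →
         G4WK ((φ ⇒' χ) ∷ (ψ ⇒' χ) ∷ Γ) Δ → G4WK Γ' Δ
  p⇒L  : ∀ {Γ Γ' p φ Δ} → Γ' ↭ (var p ∷ (var p ⇒' φ) ∷ Γ) →
         G4WK (var p ∷ φ ∷ Γ) Δ → G4WK Γ' Δ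
  ⇒⇒L  : ∀ {Γ Γ' φ ψ χ Δ} → Γ' ↭ (((φ ⇒' ψ) ⇒' χ) ∷ Γ) →
         G4WK ((ψ ⇒' χ) ∷ Γ) (just (φ ⇒' ψ)) → G4WK (χ ∷ Γ) Δ → G4WK Γ' Δ
  □R   : ∀ {Γ φ} → G4WK (box⁻¹ Γ) (just φ) → G4WK Γ (just (□ φ))
  □⇒L  : ∀ {Γ Γ' φ ψ Δ} → Γ' ↭ ((□ φ ⇒' ψ) ∷ Γ) →
         G4WK (box⁻¹ Γ) (just φ) → G4WK (ψ ∷ Γ) Δ → G4WK Γ' Δ
  ◇⇒L  : ∀ {Γ Γ' γ φ ψ Δ} → Γ' ↭ (◇ γ ∷ (◇ φ ⇒' ψ) ∷ Γ) →
         G4WK (γ ∷ box⁻¹ Γ) (just φ) → G4WK (◇ γ ∷ ψ ∷ Γ) Δ → G4WK Γ' Δ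
  ◇L'  : ∀ {Γ Γ' φ Δ} → Γ' ↭ (◇ φ ∷ Γ) →
         G4WK (φ ∷ box⁻¹ Γ) (dia⁻¹ Δ) → G4WK Γ' Δ

module Submission where

-- Cut is shown admissible, following Dyckhoff and Negri, in an auxiliary calculus Der≤ with explicit
-- height bounds that covers G4CK and G4WK at once, and in which exchange, weakening and the inversion
-- of left rules are height-preserving. Contraction is admissible by induction on the weight of the
-- contracted formula and the height; its hard case, a principal (φ ⇒ ψ) ⇒ χ, needs the inversion
-- φ, ψ ⇒ χ of ⇒⇒L, which in turn needs a generalised modus ponens, proved simultaneously for every
-- residue of an implication under invertible steps. Cut is then eliminated by induction on the weight
-- of the cut formula and the heights: principal cuts reduce to cuts on lighter formulas (for an
-- implication, by cases on the left rule using it), all other cuts are permuted into the premises.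

open import Defs
open import Data.Empty using (⊥; ⊥-elim)
open import Data.List using (List; []; [_]; _∷_; _++_; mapMaybe)
open import Data.List.Properties using (++-assoc; mapMaybe-++)
open import Data.List.Membership.Propositional using (_∈_)
open import Data.List.Membership.Propositional.Properties using (∈-++⁺ʳ; ∈-++⁻; ∈-∃++)
open import Data.List.Relation.Unary.Any using (here; there)
open import Data.List.Relation.Binary.Permutation.Propositional
open import Data.List.Relation.Binary.Permutation.Propositional.Properties
  using (∈-resp-↭; drop-∷; shift; shifts; ++⁺ˡ; ++⁺ʳ; ↭-singleton-inv; mapMaybe-↭)
open import Data.Maybe using (Maybe; just; nothing)
open import Data.Nat using (ℕ; suc; _+_; _<_; _≤_; _⊔_; s≤s; s≤s⁻¹)
open import Data.Nat.Properties
  using ( ≤-refl; ≤-trans; ≤-reflexive; <-≤-trans; <-trans; n≤1+n; m≤m+n; m≤n+m; m≤m⊔n; m≤n⊔m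
        ; +-monoˡ-≤; +-suc; +-assoc)
open import Data.Product using (Σ; _×_; _,_; proj₂)
open import Data.Sum using (_⊎_; inj₁; inj₂)
open import Data.Unit using (⊤; tt)
open import Function using (_∘_; id)
open import Relation.Binary.Construct.Closure.ReflexiveTransitive using (Star; ε; _◅_; _◅◅_)
open import Relation.Binary.PropositionalEquality using (_≡_; _≢_; refl; sym; cong; subst)

-- A conjunction weighs one more than a disjunction, so that φ ⇒ (ψ ⇒ χ) is lighter than (φ ∧ ψ) ⇒ χ.
weight : Fm → ℕ
weight (var _)  = 1
weight ⊥'       = 1
weight (φ ∧' ψ) = 2 + weight φ + weight ψ
weight (φ ∨' ψ) = 1 + weight φ + weight ψ
weight (φ ⇒' ψ) = 1 + weight φ + weight ψ
weight (□ φ)    = 1 + weight φ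
weight (◇ φ)    = 1 + weight φ

infix 3 _≺_

record _≺_ (φ ψ : Fm) : Set where
  constructor weight<
  field weight-< : weight φ < weight ψ

open _≺_

≺-∨ˡ : ∀ {φ ψ} → φ ≺ φ ∨' ψ
≺-∨ˡ {φ} {ψ} = weight< (s≤s (m≤m+n (weight φ) (weight ψ)))

≺-∨ʳ : ∀ {φ ψ} → ψ ≺ φ ∨' ψ
≺-∨ʳ {φ} {ψ} = weight< (s≤s (m≤n+m (weight ψ) (weight φ)))

≺-⇒ˡ : ∀ {φ ψ} → φ ≺ φ ⇒' ψ
≺-⇒ˡ {φ} {ψ} = weight< (s≤s (m≤m+n (weight φ) (weight ψ)))

≺-⇒ʳ : ∀ {φ ψ} → ψ ≺ φ ⇒' ψ
≺-⇒ʳ {φ} {ψ} = weight< (s≤s (m≤n+m (weight ψ) (weight φ)))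

≺-∧ˡ : ∀ {φ ψ} → φ ≺ φ ∧' ψ
≺-∧ˡ {φ} {ψ} = weight< (≤-trans (weight-< (≺-∨ˡ {φ} {ψ})) (n≤1+n _))

≺-∧ʳ : ∀ {φ ψ} → ψ ≺ φ ∧' ψ
≺-∧ʳ {φ} {ψ} = weight< (≤-trans (weight-< (≺-∨ʳ {φ} {ψ})) (n≤1+n _))

≺-□ : ∀ {φ} → φ ≺ □ φ
≺-□ = weight< ≤-refl

≺-◇ : ∀ {φ} → φ ≺ ◇ φ
≺-◇ = weight< ≤-refl

≺-curry : ∀ {φ ψ χ} → φ ⇒' (ψ ⇒' χ) ≺ (φ ∧' ψ) ⇒' χ
≺-curry {φ} {ψ} {χ} = weight< (≤-reflexive (cong (2 +_) (+-assoc-suc (weight φ) (weight ψ) (weight χ))))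
  where
  +-assoc-suc : ∀ x y z → x + suc (y + z) ≡ suc (x + y + z)
  +-assoc-suc x y z rewrite +-suc x (y + z) | +-assoc x y z = refl

≺-∨⇒ˡ : ∀ {φ ψ χ} → φ ⇒' χ ≺ (φ ∨' ψ) ⇒' χ
≺-∨⇒ˡ {φ} {ψ} {χ} = weight< (s≤s (s≤s (+-monoˡ-≤ (weight χ) (m≤m+n (weight φ) (weight ψ)))))

≺-∨⇒ʳ : ∀ {φ ψ χ} → ψ ⇒' χ ≺ (φ ∨' ψ) ⇒' χ
≺-∨⇒ʳ {φ} {ψ} {χ} = weight< (s≤s (s≤s (+-monoˡ-≤ (weight χ) (m≤n+m (weight ψ) (weight φ)))))

≺-⇒⇒ : ∀ {φ ψ χ} → ψ ⇒' χ ≺ (φ ⇒' ψ) ⇒' χ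
≺-⇒⇒ {φ} {ψ} {χ} = weight< (s≤s (s≤s (+-monoˡ-≤ (weight χ) (m≤n+m (weight ψ) (weight φ)))))

≺-∧⇒ : ∀ {φ ψ χ} → ψ ⇒' χ ≺ (φ ∧' ψ) ⇒' χ
≺-∧⇒ {φ} {ψ} {χ} = weight< (≤-trans (weight-< (≺-∨⇒ʳ {φ} {ψ} {χ})) (n≤1+n _))

≺-⇒⇒ˡ : ∀ {φ ψ χ} → φ ≺ (φ ⇒' ψ) ⇒' χ
≺-⇒⇒ˡ {φ} {ψ} {χ} = weight< (<-trans (weight-< (≺-⇒ˡ {φ} {ψ})) (weight-< (≺-⇒ˡ {φ ⇒' ψ} {χ})))

below : ∀ {φ ψ k} → φ ≺ ψ → weight ψ < suc k → weight φ < k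
below φ≺ψ ψ<1+k = <-≤-trans (weight-< φ≺ψ) (s≤s⁻¹ ψ<1+k)

unbox : Fm → Maybe Fm
unbox (□ φ) = just φ
unbox _     = nothing

box⁻¹≡mapMaybe : ∀ Γ → box⁻¹ Γ ≡ mapMaybe unbox Γ
box⁻¹≡mapMaybe []             = refl
box⁻¹≡mapMaybe (var _ ∷ Γ)    = box⁻¹≡mapMaybe Γ
box⁻¹≡mapMaybe (⊥' ∷ Γ)       = box⁻¹≡mapMaybe Γ
box⁻¹≡mapMaybe ((_ ∧' _) ∷ Γ) = box⁻¹≡mapMaybe Γ
box⁻¹≡mapMaybe ((_ ∨' _) ∷ Γ) = box⁻¹≡mapMaybe Γ
box⁻¹≡mapMaybe ((_ ⇒' _) ∷ Γ) = box⁻¹≡mapMaybe Γ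
box⁻¹≡mapMaybe (□ φ ∷ Γ)      = cong (φ ∷_) (box⁻¹≡mapMaybe Γ)
box⁻¹≡mapMaybe (◇ _ ∷ Γ)      = box⁻¹≡mapMaybe Γ

box⁻¹-++ : ∀ Γ Γ' → box⁻¹ (Γ ++ Γ') ≡ box⁻¹ Γ ++ box⁻¹ Γ'
box⁻¹-++ Γ Γ' rewrite box⁻¹≡mapMaybe (Γ ++ Γ') | box⁻¹≡mapMaybe Γ | box⁻¹≡mapMaybe Γ' = mapMaybe-++ unbox Γ Γ'

box⁻¹-↭ : ∀ {Γ Γ'} → Γ ↭ Γ' → box⁻¹ Γ ↭ box⁻¹ Γ'
box⁻¹-↭ {Γ} {Γ'} ρ rewrite box⁻¹≡mapMaybe Γ | box⁻¹≡mapMaybe Γ' = mapMaybe-↭ unbox ρ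

box⁻¹-∷-unboxed : ∀ {φ} Γ → unbox φ ≡ nothing → box⁻¹ (φ ∷ Γ) ≡ box⁻¹ Γ
box⁻¹-∷-unboxed {φ} Γ eq rewrite box⁻¹≡mapMaybe (φ ∷ Γ) | box⁻¹≡mapMaybe Γ | eq = refl

∈⇒↭∷ : ∀ {x : Fm} {Γ} → x ∈ Γ → Σ (List Fm) λ Γ' → Γ ↭ x ∷ Γ'
∈⇒↭∷ x∈Γ with ∈-∃++ x∈Γ
... | Γ₁ , Γ₂ , refl = Γ₁ ++ Γ₂ , shift _ Γ₁ Γ₂

↭∷⇒∈ : ∀ {x : Fm} {Γ Γ'} → Γ ↭ x ∷ Γ' → x ∈ Γ
↭∷⇒∈ ρ = ∈-resp-↭ (↭-sym ρ) (here refl)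

∷↭∷-inv : ∀ {x y : Fm} {Γ Γ'} → x ∷ Γ ↭ y ∷ Γ' →
          (x ≡ y × Γ ↭ Γ') ⊎ (Σ (List Fm) λ Γ₀ → (Γ ↭ y ∷ Γ₀) × (Γ' ↭ x ∷ Γ₀))
∷↭∷-inv {x} {y} ρ with ∈-resp-↭ (↭-sym ρ) (here refl)
... | here refl = inj₁ (refl , drop-∷ ρ)
... | there y∈Γ with ∈-∃++ y∈Γ
... | Γ₁ , Γ₂ , refl = inj₂ (Γ₁ ++ Γ₂ , shift y Γ₁ Γ₂ ,
        drop-∷ (trans (↭-sym ρ) (trans (prep x (shift y Γ₁ Γ₂)) (swap x y refl))))

-- A height-bounded calculus covering both G4CK and G4WK

data Calculus : Set where
  CK WK : Calculus

-- G4CK's ◇L is ◇L' restricted to succedents ◇ψ, for which ◇⁻¹ yields ψ.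
data ◇L-allowed : Calculus → Maybe Fm → Set where
  any-succedent : ∀ {Δ} → ◇L-allowed WK Δ
  ◇-succedent   : ∀ {S φ} → ◇L-allowed S (just (◇ φ))

Irreducible : Fm → Set
Irreducible (var _) = ⊤
Irreducible ⊥'      = ⊤
Irreducible (□ _)   = ⊤
Irreducible (◇ _)   = ⊤
Irreducible _       = ⊥

infix 3 _▹_

-- The height-preserving inversions of left rules: every premise of an invertible rule, the right
-- premise of the other implication rules, and ⊥ ⇒ χ, which is never principal.
data _▹_ : Fm → List Fm → Set where
  ∧▹   : ∀ {φ ψ} → φ ∧' ψ ▹ φ ∷ ψ ∷ []
  ∨▹ˡ  : ∀ {φ ψ} → φ ∨' ψ ▹ [ φ ]
  ∨▹ʳ  : ∀ {φ ψ} → φ ∨' ψ ▹ [ ψ ]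
  ∧⇒▹  : ∀ {φ ψ χ} → (φ ∧' ψ) ⇒' χ ▹ [ φ ⇒' (ψ ⇒' χ) ]
  ∨⇒▹  : ∀ {φ ψ χ} → (φ ∨' ψ) ⇒' χ ▹ (φ ⇒' χ) ∷ (ψ ⇒' χ) ∷ []
  ⊥⇒▹  : ∀ {χ} → ⊥' ⇒' χ ▹ [ χ ]
  p⇒▹  : ∀ {p χ} → var p ⇒' χ ▹ [ χ ]
  ⇒⇒▹  : ∀ {φ ψ χ} → (φ ⇒' ψ) ⇒' χ ▹ [ χ ]
  □⇒▹  : ∀ {φ χ} → □ φ ⇒' χ ▹ [ χ ]
  ◇⇒▹  : ∀ {φ χ} → ◇ φ ⇒' χ ▹ [ χ ]

-- The side formulas p of p⇒L and ◇γ of ◇⇒L stay in the context Γ.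
data LeftRule (P : List Fm → Maybe Fm → Set) : Fm → List Fm → Maybe Fm → Set where
  ∧L  : ∀ {φ ψ Γ Δ} → P (φ ∷ ψ ∷ Γ) Δ → LeftRule P (φ ∧' ψ) Γ Δ
  ∨L  : ∀ {φ ψ Γ Δ} → P (φ ∷ Γ) Δ → P (ψ ∷ Γ) Δ → LeftRule P (φ ∨' ψ) Γ Δ
  ∧⇒L : ∀ {φ ψ χ Γ Δ} → P ((φ ⇒' (ψ ⇒' χ)) ∷ Γ) Δ → LeftRule P ((φ ∧' ψ) ⇒' χ) Γ Δ
  ∨⇒L : ∀ {φ ψ χ Γ Δ} → P ((φ ⇒' χ) ∷ (ψ ⇒' χ) ∷ Γ) Δ → LeftRule P ((φ ∨' ψ) ⇒' χ) Γ Δ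
  p⇒L : ∀ {p χ Γ Δ} → var p ∈ Γ → P (χ ∷ Γ) Δ → LeftRule P (var p ⇒' χ) Γ Δ
  ⇒⇒L : ∀ {φ ψ χ Γ Δ} → P ((ψ ⇒' χ) ∷ Γ) (just (φ ⇒' ψ)) → P (χ ∷ Γ) Δ → LeftRule P ((φ ⇒' ψ) ⇒' χ) Γ Δ
  □⇒L : ∀ {φ χ Γ Δ} → P (box⁻¹ Γ) (just φ) → P (χ ∷ Γ) Δ → LeftRule P (□ φ ⇒' χ) Γ Δ
  ◇⇒L : ∀ {φ γ χ Γ Δ} → ◇ γ ∈ Γ → P (γ ∷ box⁻¹ Γ) (just φ) → P (χ ∷ Γ) Δ → LeftRule P (◇ φ ⇒' χ) Γ Δ

-- The index n bounds the height. Principal formulas are found by membership or, in L, through a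
-- permutation of the context, which makes exchange height-preserving for free.
data Der≤ (S : Calculus) : ℕ → List Fm → Maybe Fm → Set where
  ⊥L  : ∀ {n Γ Δ} → ⊥' ∈ Γ → Der≤ S (suc n) Γ Δ
  IdP : ∀ {n Γ p} → var p ∈ Γ → Der≤ S (suc n) Γ (just (var p))
  ∧R  : ∀ {n Γ φ ψ} → Der≤ S n Γ (just φ) → Der≤ S n Γ (just ψ) → Der≤ S (suc n) Γ (just (φ ∧' ψ))
  ∨R₁ : ∀ {n Γ φ ψ} → Der≤ S n Γ (just φ) → Der≤ S (suc n) Γ (just (φ ∨' ψ))
  ∨R₂ : ∀ {n Γ φ ψ} → Der≤ S n Γ (just ψ) → Der≤ S (suc n) Γ (just (φ ∨' ψ))
  ⇒R  : ∀ {n Γ φ ψ} → Der≤ S n (φ ∷ Γ) (just ψ) → Der≤ S (suc n) Γ (just (φ ⇒' ψ))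
  □R  : ∀ {n Γ φ} → Der≤ S n (box⁻¹ Γ) (just φ) → Der≤ S (suc n) Γ (just (□ φ))
  ◇L  : ∀ {n Γ φ Δ} → ◇ φ ∈ Γ → ◇L-allowed S Δ → Der≤ S n (φ ∷ box⁻¹ Γ) (dia⁻¹ Δ) → Der≤ S (suc n) Γ Δ
  L   : ∀ {n Γ Γ' G Δ} → Γ' ↭ G ∷ Γ → LeftRule (Der≤ S n) G Γ Δ → Der≤ S (suc n) Γ' Δ

Der : Calculus → List Fm → Maybe Fm → Set
Der S Γ Δ = Σ ℕ λ n → Der≤ S n Γ Δ

LeftRule-map : ∀ {P Q : List Fm → Maybe Fm → Set} {G Γ Γ' Δ Δ'}
  → (∀ {ψ} → Irreducible ψ → ψ ∈ Γ → ψ ∈ Γ')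
  → (∀ {X} → G ▹ X → P (X ++ Γ) Δ → Q (X ++ Γ') Δ')
  → (∀ {Y F} → P (Y ∷ Γ) F → Q (Y ∷ Γ') F)
  → (∀ {Z F} → P (Z ++ box⁻¹ Γ) F → Q (Z ++ box⁻¹ Γ') F)
  → LeftRule P G Γ Δ → LeftRule Q G Γ' Δ'
LeftRule-map side main ⇒⇒-left modal (∧L d)        = ∧L (main ∧▹ d)
LeftRule-map side main ⇒⇒-left modal (∨L d e)      = ∨L (main ∨▹ˡ d) (main ∨▹ʳ e)
LeftRule-map side main ⇒⇒-left modal (∧⇒L d)       = ∧⇒L (main ∧⇒▹ d)
LeftRule-map side main ⇒⇒-left modal (∨⇒L d)       = ∨⇒L (main ∨⇒▹ d)
LeftRule-map side main ⇒⇒-left modal (p⇒L p∈ d)    = p⇒L (side tt p∈) (main p⇒▹ d)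
LeftRule-map side main ⇒⇒-left modal (⇒⇒L d e)     = ⇒⇒L (⇒⇒-left d) (main ⇒⇒▹ e)
LeftRule-map side main ⇒⇒-left modal (□⇒L d e)     = □⇒L (modal {[]} d) (main □⇒▹ e)
LeftRule-map side main ⇒⇒-left modal (◇⇒L ◇γ∈ d e) = ◇⇒L (side tt ◇γ∈) (modal {[ _ ]} d) (main ◇⇒▹ e)

-- Height-preserving structural rules

raise : ∀ {S m n Γ Δ} → m ≤ n → Der≤ S m Γ Δ → Der≤ S n Γ Δ
raise (s≤s m≤n) (⊥L ⊥∈)       = ⊥L ⊥∈
raise (s≤s m≤n) (IdP p∈)      = IdP p∈
raise (s≤s m≤n) (∧R d e)      = ∧R (raise m≤n d) (raise m≤n e)
raise (s≤s m≤n) (∨R₁ d)       = ∨R₁ (raise m≤n d)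
raise (s≤s m≤n) (∨R₂ d)       = ∨R₂ (raise m≤n d)
raise (s≤s m≤n) (⇒R d)        = ⇒R (raise m≤n d)
raise (s≤s m≤n) (□R d)        = □R (raise m≤n d)
raise (s≤s m≤n) (◇L ◇φ∈ ok d) = ◇L ◇φ∈ ok (raise m≤n d)
raise (s≤s m≤n) (L σ r)       = L σ (LeftRule-map (λ _ → id) (λ _ → raise m≤n) (raise m≤n) (raise m≤n) r)

raise₁ : ∀ {S n Γ Δ} → Der≤ S n Γ Δ → Der≤ S (suc n) Γ Δ
raise₁ = raise (n≤1+n _)

module _ {S : Calculus} {m n : ℕ} where

  raise-⊔ˡ : ∀ {Γ Δ} → Der≤ S m Γ Δ → Der≤ S (m ⊔ n) Γ Δ
  raise-⊔ˡ = raise (m≤m⊔n m n)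

  raise-⊔ʳ : ∀ {Γ Δ} → Der≤ S n Γ Δ → Der≤ S (m ⊔ n) Γ Δ
  raise-⊔ʳ = raise (m≤n⊔m m n)

LeftRule-align : ∀ {S G Γ Δ} → LeftRule (Der S) G Γ Δ → Σ ℕ λ n → LeftRule (Der≤ S n) G Γ Δ
LeftRule-align (∧L (n , d))              = n , ∧L d
LeftRule-align (∨L (m , d) (n , e))      = m ⊔ n , ∨L (raise-⊔ˡ d) (raise-⊔ʳ e)
LeftRule-align (∧⇒L (n , d))             = n , ∧⇒L d
LeftRule-align (∨⇒L (n , d))             = n , ∨⇒L d
LeftRule-align (p⇒L p∈ (n , d))          = n , p⇒L p∈ d
LeftRule-align (⇒⇒L (m , d) (n , e))     = m ⊔ n , ⇒⇒L (raise-⊔ˡ d) (raise-⊔ʳ e)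
LeftRule-align (□⇒L (m , d) (n , e))     = m ⊔ n , □⇒L (raise-⊔ˡ d) (raise-⊔ʳ e)
LeftRule-align (◇⇒L ◇γ∈ (m , d) (n , e)) = m ⊔ n , ◇⇒L ◇γ∈ (raise-⊔ˡ d) (raise-⊔ʳ e)

leftRule : ∀ {S Γ' G Γ Δ} → Γ' ↭ G ∷ Γ → LeftRule (Der S) G Γ Δ → Der S Γ' Δ
leftRule σ r with LeftRule-align r
... | n , r' = suc n , L σ r'

∧Rᵈ : ∀ {S Γ φ ψ} → Der S Γ (just φ) → Der S Γ (just ψ) → Der S Γ (just (φ ∧' ψ))
∧Rᵈ (m , d) (n , e) = suc (m ⊔ n) , ∧R (raise-⊔ˡ d) (raise-⊔ʳ e)

∨R₁ᵈ : ∀ {S Γ φ ψ} → Der S Γ (just φ) → Der S Γ (just (φ ∨' ψ))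
∨R₁ᵈ (n , d) = suc n , ∨R₁ d

∨R₂ᵈ : ∀ {S Γ φ ψ} → Der S Γ (just ψ) → Der S Γ (just (φ ∨' ψ))
∨R₂ᵈ (n , d) = suc n , ∨R₂ d

⇒Rᵈ : ∀ {S Γ φ ψ} → Der S (φ ∷ Γ) (just ψ) → Der S Γ (just (φ ⇒' ψ))
⇒Rᵈ (n , d) = suc n , ⇒R d

□Rᵈ : ∀ {S Γ φ} → Der S (box⁻¹ Γ) (just φ) → Der S Γ (just (□ φ))
□Rᵈ (n , d) = suc n , □R d

◇Lᵈ : ∀ {S Γ φ Δ} → ◇ φ ∈ Γ → ◇L-allowed S Δ → Der S (φ ∷ box⁻¹ Γ) (dia⁻¹ Δ) → Der S Γ Δ
◇Lᵈ ◇φ∈ ok (n , d) = suc n , ◇L ◇φ∈ ok d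

Der-map : ∀ {S Γ Γ' Δ Δ'} → (∀ {n} → Der≤ S n Γ Δ → Der≤ S n Γ' Δ') → Der S Γ Δ → Der S Γ' Δ'
Der-map f (n , d) = n , f d

exchange : ∀ {S n Γ Γ' Δ} → Γ ↭ Γ' → Der≤ S n Γ Δ → Der≤ S n Γ' Δ
exchange ρ (⊥L ⊥∈)        = ⊥L (∈-resp-↭ ρ ⊥∈)
exchange ρ (IdP p∈)       = IdP (∈-resp-↭ ρ p∈)
exchange ρ (∧R d e)       = ∧R (exchange ρ d) (exchange ρ e)
exchange ρ (∨R₁ d)        = ∨R₁ (exchange ρ d)
exchange ρ (∨R₂ d)        = ∨R₂ (exchange ρ d)
exchange ρ (⇒R d)         = ⇒R (exchange (prep _ ρ) d)
exchange ρ (□R d)         = □R (exchange (box⁻¹-↭ ρ) d)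
exchange ρ (◇L ◇φ∈ ok d)  = ◇L (∈-resp-↭ ρ ◇φ∈) ok (exchange (prep _ (box⁻¹-↭ ρ)) d)
exchange ρ (L σ r)        = L (trans (↭-sym ρ) σ) r

exchangeᵈ : ∀ {S Γ Γ' Δ} → Γ ↭ Γ' → Der S Γ Δ → Der S Γ' Δ
exchangeᵈ ρ = Der-map (exchange ρ)

mutual
  weakenˡ : ∀ {S n} Ψ {Γ Δ} → Der≤ S n Γ Δ → Der≤ S n (Ψ ++ Γ) Δ
  weakenˡ Ψ (⊥L ⊥∈)       = ⊥L (∈-++⁺ʳ Ψ ⊥∈)
  weakenˡ Ψ (IdP p∈)      = IdP (∈-++⁺ʳ Ψ p∈)
  weakenˡ Ψ (∧R d e)      = ∧R (weakenˡ Ψ d) (weakenˡ Ψ e)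
  weakenˡ Ψ (∨R₁ d)       = ∨R₁ (weakenˡ Ψ d)
  weakenˡ Ψ (∨R₂ d)       = ∨R₂ (weakenˡ Ψ d)
  weakenˡ Ψ (⇒R d)        = ⇒R (weaken-under Ψ d)
  weakenˡ Ψ (□R d)        = □R (weaken-boxed Ψ [] d)
  weakenˡ Ψ (◇L ◇φ∈ ok d) = ◇L (∈-++⁺ʳ Ψ ◇φ∈) ok (weaken-boxed Ψ [ _ ] d)
  weakenˡ Ψ (L {Γ = Γ₀} {G = G} σ r) = L (trans (++⁺ˡ Ψ σ) (shift G Ψ Γ₀))
    (LeftRule-map (λ _ → ∈-++⁺ʳ Ψ) (λ {X} _ d → exchange (shifts Ψ X) (weakenˡ Ψ d))
                  (weaken-under Ψ) (λ {Z} → weaken-boxed Ψ Z) r)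

  weaken-under : ∀ {S n} Ψ {φ Γ Δ} → Der≤ S n (φ ∷ Γ) Δ → Der≤ S n (φ ∷ Ψ ++ Γ) Δ
  weaken-under Ψ {φ} {Γ} d = exchange (shift φ Ψ Γ) (weakenˡ Ψ d)

  weaken-boxed : ∀ {S n} Ψ Z {Γ Δ} → Der≤ S n (Z ++ box⁻¹ Γ) Δ → Der≤ S n (Z ++ box⁻¹ (Ψ ++ Γ)) Δ
  weaken-boxed Ψ Z {Γ} d =
    exchange (trans (shifts (box⁻¹ Ψ) Z) (↭-reflexive (cong (Z ++_) (sym (box⁻¹-++ Ψ Γ))))) (weakenˡ (box⁻¹ Ψ) d)

weaken : ∀ {S n} φ {Γ Δ} → Der≤ S n Γ Δ → Der≤ S n (φ ∷ Γ) Δ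
weaken φ = weakenˡ [ φ ]

weakenᵈ : ∀ {S} Ψ {Γ Δ} → Der S Γ Δ → Der S (Ψ ++ Γ) Δ
weakenᵈ Ψ = Der-map (weakenˡ Ψ)

weakenʳ : ∀ {S n Γ Δ} → Der≤ S n Γ nothing → Der≤ S n Γ Δ
weakenʳ (⊥L ⊥∈)                  = ⊥L ⊥∈
weakenʳ (◇L ◇φ∈ any-succedent d) = ◇L ◇φ∈ any-succedent (weakenʳ d)
weakenʳ (L σ r)                  = L σ (LeftRule-map (λ _ → id) (λ _ → weakenʳ) id id r)

-- Height-preserving inversion

▹-reducible : ∀ {G X} → G ▹ X → Irreducible G → ⊥
▹-reducible ∧▹  ()
▹-reducible ∨▹ˡ ()
▹-reducible ∨▹ʳ ()
▹-reducible ∧⇒▹ ()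
▹-reducible ∨⇒▹ ()
▹-reducible ⊥⇒▹ ()
▹-reducible p⇒▹ ()
▹-reducible ⇒⇒▹ ()
▹-reducible □⇒▹ ()
▹-reducible ◇⇒▹ ()

▹-unboxed : ∀ {G X} → G ▹ X → unbox G ≡ nothing
▹-unboxed ∧▹  = refl
▹-unboxed ∨▹ˡ = refl
▹-unboxed ∨▹ʳ = refl
▹-unboxed ∧⇒▹ = refl
▹-unboxed ∨⇒▹ = refl
▹-unboxed ⊥⇒▹ = refl
▹-unboxed p⇒▹ = refl
▹-unboxed ⇒⇒▹ = refl
▹-unboxed □⇒▹ = refl
▹-unboxed ◇⇒▹ = refl

▹-premise : ∀ {P G X Γ Δ} → G ▹ X → LeftRule P G Γ Δ → P (X ++ Γ) Δ
▹-premise ∧▹  (∧L d)       = d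
▹-premise ∨▹ˡ (∨L d _)     = d
▹-premise ∨▹ʳ (∨L _ e)     = e
▹-premise ∧⇒▹ (∧⇒L d)      = d
▹-premise ∨⇒▹ (∨⇒L d)      = d
▹-premise p⇒▹ (p⇒L _ d)    = d
▹-premise ⇒⇒▹ (⇒⇒L _ e)    = e
▹-premise □⇒▹ (□⇒L _ e)    = e
▹-premise ◇⇒▹ (◇⇒L _ _ e)  = e

∈-∷-▹ : ∀ {G X ψ Γ} → G ▹ X → Irreducible ψ → ψ ∈ G ∷ Γ → ψ ∈ Γ
∈-∷-▹ s irr (here refl) = ⊥-elim (▹-reducible s irr)
∈-∷-▹ s irr (there ψ∈) = ψ∈

box⁻¹-∷-▹ : ∀ {G X} Γ → G ▹ X → box⁻¹ (G ∷ Γ) ≡ box⁻¹ Γ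
box⁻¹-∷-▹ Γ s = box⁻¹-∷-unboxed Γ (▹-unboxed s)

invert : ∀ {S n G X Γ Δ} → G ▹ X → Der≤ S n (G ∷ Γ) Δ → Der≤ S n (X ++ Γ) Δ
invert {X = X} s (⊥L ⊥∈)  = ⊥L (∈-++⁺ʳ X (∈-∷-▹ s tt ⊥∈))
invert {X = X} s (IdP p∈) = IdP (∈-++⁺ʳ X (∈-∷-▹ s tt p∈))
invert s (∧R d e)         = ∧R (invert s d) (invert s e)
invert s (∨R₁ d)          = ∨R₁ (invert s d)
invert s (∨R₂ d)          = ∨R₂ (invert s d)
invert {G = G} {X} {Γ} s (⇒R {φ = φ} d) =
  ⇒R (exchange (shift φ X Γ) (invert s (exchange (swap φ G refl) d)))
invert {X = X} {Γ} s (□R d) =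
  □R (weaken-boxed X [] (exchange (↭-reflexive (box⁻¹-∷-▹ Γ s)) d))
invert {X = X} {Γ} s (◇L {φ = φ} ◇φ∈ ok d) =
  ◇L (∈-++⁺ʳ X (∈-∷-▹ s tt ◇φ∈)) ok
     (weaken-boxed X [ φ ] (exchange (↭-reflexive (cong (φ ∷_) (box⁻¹-∷-▹ Γ s))) d))
invert {G = G} {X} s (L σ r) with ∷↭∷-inv σ
... | inj₁ (refl , ρ) = raise₁ (exchange (++⁺ˡ X (↭-sym ρ)) (▹-premise s r))
... | inj₂ (Γ₁ , ρ₁ , ρ₂) = L (trans (++⁺ˡ X ρ₁) (shift _ X Γ₁))
  (LeftRule-map (λ irr ψ∈ → ∈-++⁺ʳ X (∈-∷-▹ s irr (∈-resp-↭ ρ₂ ψ∈)))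
    (λ {Y} _ → invert-under Y) (λ {Y} → invert-under [ Y ])
    (λ {Z} → weaken-boxed X Z ∘ exchange (trans (++⁺ˡ Z (box⁻¹-↭ ρ₂)) (↭-reflexive (cong (Z ++_) (box⁻¹-∷-▹ Γ₁ s)))))
    r)
  where
  invert-under : ∀ {n} Y {Δ} → Der≤ _ n (Y ++ _) Δ → Der≤ _ n (Y ++ X ++ Γ₁) Δ
  invert-under Y d = exchange (shifts X Y) (invert s (exchange (trans (++⁺ˡ Y ρ₂) (shift G Y Γ₁)) d))

invertᵈ : ∀ {S G X Γ Δ} → G ▹ X → Der S (G ∷ Γ) Δ → Der S (X ++ Γ) Δ
invertᵈ s = Der-map (invert s)

⇒R-inv : ∀ {S n Γ φ ψ} → Der≤ S n Γ (just (φ ⇒' ψ)) → Der≤ S n (φ ∷ Γ) (just ψ)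
⇒R-inv (⊥L ⊥∈) = ⊥L (there ⊥∈)
⇒R-inv (⇒R d)  = raise₁ d
⇒R-inv {φ = φ} (◇L ◇γ∈ any-succedent d) =
  ◇L (there ◇γ∈) any-succedent (weaken-boxed [ φ ] [ _ ] (weakenʳ d))
⇒R-inv {φ = φ} (L {Γ = Γ₀} {G = G} σ r) = L (trans (prep φ σ) (swap φ G refl))
  (LeftRule-map (λ _ → there) (λ {X} _ d → exchange (↭-sym (shift φ X Γ₀)) (⇒R-inv d))
                (weaken-under [ φ ]) (λ {Z} → weaken-boxed [ φ ] Z) r)

LeftRule-exchange : ∀ {S n G Γ Γ' Δ} → Γ ↭ Γ' → LeftRule (Der≤ S n) G Γ Δ → LeftRule (Der≤ S n) G Γ' Δ
LeftRule-exchange ρ = LeftRule-map (λ _ → ∈-resp-↭ ρ) (λ {X} _ → exchange (++⁺ˡ X ρ))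
                                   (exchange (prep _ ρ)) (λ {Z} → exchange (++⁺ˡ Z (box⁻¹-↭ ρ)))

invertᵈ-tail : ∀ {S B G X Γ Δ} → G ▹ X → Der S (B ∷ G ∷ Γ) Δ → Der S (B ∷ X ++ Γ) Δ
invertᵈ-tail {B = B} {G} {X} {Γ} s = exchangeᵈ (shift B X Γ) ∘ invertᵈ s ∘ exchangeᵈ (swap B G refl)

-- Contraction and the generalised modus ponens

data Dia-view : Fm → Set where
  is-◇  : ∀ φ → Dia-view (◇ φ)
  not-◇ : ∀ {φ} → dia⁻¹ (just φ) ≡ nothing → Dia-view φ

dia-view : ∀ φ → Dia-view φ
dia-view (var _)  = not-◇ refl
dia-view ⊥'       = not-◇ refl
dia-view (_ ∧' _) = not-◇ refl
dia-view (_ ∨' _) = not-◇ refl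
dia-view (_ ⇒' _) = not-◇ refl
dia-view (□ _)    = not-◇ refl
dia-view (◇ φ)    = is-◇ φ

-- Only G4WK can end in ◇L' with a succedent other than ◇ψ, and then the premise has an empty succedent.
◇L-nonDia : ∀ {S n Γ φ A Δ} → ◇ φ ∈ Γ → ◇L-allowed S (just A) → dia⁻¹ (just A) ≡ nothing →
            Der≤ S n (φ ∷ box⁻¹ Γ) (dia⁻¹ (just A)) → Der S Γ Δ
◇L-nonDia ◇φ∈ any-succedent eq d = _ , ◇L ◇φ∈ any-succedent (weakenʳ (subst (Der≤ _ _ _) eq d))

▹-weight : ∀ {G X H} → G ▹ X → H ∈ X → H ≺ G
▹-weight (∧▹ {φ} {ψ})      (here refl)         = ≺-∧ˡ {φ} {ψ}
▹-weight (∧▹ {φ} {ψ})      (there (here refl)) = ≺-∧ʳ {φ} {ψ}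
▹-weight (∨▹ˡ {φ} {ψ})     (here refl)         = ≺-∨ˡ {φ} {ψ}
▹-weight (∨▹ʳ {φ} {ψ})     (here refl)         = ≺-∨ʳ {φ} {ψ}
▹-weight (∧⇒▹ {φ} {ψ} {χ}) (here refl)         = ≺-curry {φ} {ψ} {χ}
▹-weight (∨⇒▹ {φ} {ψ} {χ}) (here refl)         = ≺-∨⇒ˡ {φ} {ψ} {χ}
▹-weight (∨⇒▹ {φ} {ψ} {χ}) (there (here refl)) = ≺-∨⇒ʳ {φ} {ψ} {χ}
▹-weight (⊥⇒▹ {χ})         (here refl)         = ≺-⇒ʳ {⊥'} {χ}
▹-weight (p⇒▹ {p} {χ})     (here refl)         = ≺-⇒ʳ {var p} {χ}
▹-weight (⇒⇒▹ {φ} {ψ} {χ}) (here refl)         = ≺-⇒ʳ {φ ⇒' ψ} {χ}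
▹-weight (□⇒▹ {φ} {χ})     (here refl)         = ≺-⇒ʳ {□ φ} {χ}
▹-weight (◇⇒▹ {φ} {χ})     (here refl)         = ≺-⇒ʳ {◇ φ} {χ}

data _▹₁_ (Θ Θ' : List Fm) : Set where
  decompose : ∀ {G Ξ X} → Θ ↭ G ∷ Ξ → G ▹ X → Θ' ↭ X ++ Ξ → Θ ▹₁ Θ'

_▹*_ : List Fm → List Fm → Set
_▹*_ = Star _▹₁_

▹*-bound : ∀ {k Ψ Θ} → (∀ {G} → G ∈ Ψ → weight G < k) → Ψ ▹* Θ → ∀ {H} → H ∈ Θ → weight H < k
▹*-bound bound ε = bound
▹*-bound {k} bound (_◅_ {j = Θ'} (decompose {X = X} ρ₁ s ρ₂) st) = ▹*-bound bound' st
  where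
  bound' : ∀ {G} → G ∈ Θ' → weight G < k
  bound' G∈ with ∈-++⁻ X (∈-resp-↭ ρ₂ G∈)
  ... | inj₁ G∈X = <-trans (weight-< (▹-weight s G∈X)) (bound (↭∷⇒∈ ρ₁))
  ... | inj₂ G∈Ξ = bound (∈-resp-↭ (↭-sym ρ₁) (there G∈Ξ))

invert* : ∀ {S n Ψ Θ Γ Δ} → Ψ ▹* Θ → Der≤ S n (Ψ ++ Γ) Δ → Der≤ S n (Θ ++ Γ) Δ
invert* ε = id
invert* {Γ = Γ} (decompose {Ξ = Ξ} {X} ρ₁ s ρ₂ ◅ st) =
  invert* st ∘ exchange (trans (↭-reflexive (sym (++-assoc X Ξ Γ))) (++⁺ʳ Γ (↭-sym ρ₂)))
  ∘ invert s ∘ exchange (++⁺ʳ Γ ρ₁)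

-- The residues Θ of A ⇒ B are what invertible left steps make of it. Modus ponens is proved for all
-- residues at once because a left rule ending its left premise may decompose a formula of Θ.
data Residue : Fm → Fm → List Fm → Set where
  whole      : ∀ {A B} → Residue A B [ A ⇒' B ]
  consequent : ∀ {A B Θ} → [ B ] ▹* Θ → Residue A B Θ
  curried    : ∀ {φ ψ B Θ} → Residue φ (ψ ⇒' B) Θ → Residue (φ ∧' ψ) B Θ
  split      : ∀ {φ ψ B Θ Θ₁ Θ₂} → Residue φ B Θ₁ → Residue ψ B Θ₂ → Θ ↭ Θ₁ ++ Θ₂ → Residue (φ ∨' ψ) B Θ

Residue-whole-▹ : ∀ {A B X} → A ⇒' B ▹ X → Residue A B (X ++ [])
Residue-whole-▹ ∧⇒▹ = curried whole
Residue-whole-▹ ∨⇒▹ = split whole whole refl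
Residue-whole-▹ ⊥⇒▹ = consequent ε
Residue-whole-▹ p⇒▹ = consequent ε
Residue-whole-▹ ⇒⇒▹ = consequent ε
Residue-whole-▹ □⇒▹ = consequent ε
Residue-whole-▹ ◇⇒▹ = consequent ε

Residue-▹ : ∀ {A B Θ G Θ' X} → Residue A B Θ → Θ ↭ G ∷ Θ' → G ▹ X → Residue A B (X ++ Θ')
Residue-▹ whole ρ s with ↭-singleton-inv (↭-sym ρ)
... | refl = Residue-whole-▹ s
Residue-▹ (consequent st) ρ s = consequent (st ◅◅ decompose ρ s refl ◅ ε)
Residue-▹ (curried r) ρ s = curried (Residue-▹ r ρ s)
Residue-▹ {G = G} {Θ'} {X} (split {Θ₁ = Θ₁} {Θ₂} r₁ r₂ ρ₁₂) ρ s
  with ∈-++⁻ Θ₁ (∈-resp-↭ ρ₁₂ (↭∷⇒∈ ρ))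
... | inj₁ G∈Θ₁ with ∈⇒↭∷ G∈Θ₁
... | Θ₁' , ρ₁ = split (Residue-▹ r₁ ρ₁ s) r₂
       (trans (++⁺ˡ X (drop-∷ (trans (↭-sym ρ) (trans ρ₁₂ (++⁺ʳ Θ₂ ρ₁)))))
              (↭-reflexive (sym (++-assoc X Θ₁' Θ₂))))
Residue-▹ {G = G} {Θ'} {X} (split {Θ₁ = Θ₁} {Θ₂} r₁ r₂ ρ₁₂) ρ s
    | inj₂ G∈Θ₂ with ∈⇒↭∷ G∈Θ₂
... | Θ₂' , ρ₂ = split r₁ (Residue-▹ r₂ ρ₂ s)
       (trans (++⁺ˡ X (drop-∷ (trans (↭-sym ρ) (trans ρ₁₂ (trans (++⁺ˡ Θ₁ ρ₂) (shift G Θ₁ Θ₂'))))))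
              (shifts X Θ₁))

∈-contract : ∀ {ψ F : Fm} {Γ} → ψ ∈ F ∷ F ∷ Γ → ψ ∈ F ∷ Γ
∈-contract (here refl) = here refl
∈-contract (there ψ∈)  = ψ∈

∷∷↭∷-inv : ∀ {F G : Fm} {Γ Γ₀} → F ∷ F ∷ Γ ↭ G ∷ Γ₀ →
           (F ≡ G × Γ₀ ↭ F ∷ Γ) ⊎ (Σ (List Fm) λ Γ₂ → (Γ ↭ G ∷ Γ₂) × (Γ₀ ↭ F ∷ F ∷ Γ₂))
∷∷↭∷-inv σ with ∷↭∷-inv σ
... | inj₁ (refl , ρ) = inj₁ (refl , ↭-sym ρ)
... | inj₂ (Γ₁ , ρ₁ , ρ₂) with ∷↭∷-inv ρ₁
...   | inj₁ (refl , ρ₃) = inj₁ (refl , trans ρ₂ (prep _ (↭-sym ρ₃)))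
...   | inj₂ (Γ₂ , ρ₄ , ρ₅) = inj₂ (Γ₂ , ρ₄ , trans ρ₂ (prep _ ρ₅))

mutual
  contract : ∀ {S} k {n F Γ Δ} → weight F < k → Der≤ S n (F ∷ F ∷ Γ) Δ → Der S (F ∷ Γ) Δ
  contract k lt (⊥L ⊥∈)  = 1 , ⊥L (∈-contract ⊥∈)
  contract k lt (IdP p∈) = 1 , IdP (∈-contract p∈)
  contract k lt (∧R d e) = ∧Rᵈ (contract k lt d) (contract k lt e)
  contract k lt (∨R₁ d)  = ∨R₁ᵈ (contract k lt d)
  contract k lt (∨R₂ d)  = ∨R₂ᵈ (contract k lt d)
  contract k {F = F} {Γ} lt (⇒R {φ = φ} d) =
    ⇒Rᵈ (exchangeᵈ (swap F φ refl) (contract k lt (exchange (↭-sym (shift φ (F ∷ F ∷ []) Γ)) d)))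
  contract k {F = F} lt (□R d) = □Rᵈ (contract-boxed k F [] lt d)
  contract k {F = F} lt (◇L {φ = φ} ◇φ∈ ok d) = ◇Lᵈ (∈-contract ◇φ∈) ok (contract-boxed k F [ φ ] lt d)
  contract k lt (L σ r) = contract-L k lt σ r

  contractᵈ : ∀ {S} k {F Γ Δ} → weight F < k → Der S (F ∷ F ∷ Γ) Δ → Der S (F ∷ Γ) Δ
  contractᵈ k lt (_ , d) = contract k lt d

  contract-list : ∀ {S} k Θ {Γ Δ} → (∀ {G} → G ∈ Θ → weight G < k) → Der S (Θ ++ Θ ++ Γ) Δ → Der S (Θ ++ Γ) Δ
  contract-list k [] bnd d = d
  contract-list k (G ∷ Θ) {Γ} bnd d =
    exchangeᵈ (shift G Θ Γ) (contract-list k Θ {G ∷ Γ} (bnd ∘ there)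
      (exchangeᵈ (trans (shifts [ G ] Θ) (++⁺ˡ Θ (shifts [ G ] Θ)))
        (contractᵈ k (bnd (here refl)) (exchangeᵈ (prep G (shift G Θ (Θ ++ Γ))) d))))

  contract-▹ : ∀ {S} k {n F X Γ Δ} → weight F < suc k → F ▹ X → Der≤ S n (X ++ F ∷ Γ) Δ → Der S (X ++ Γ) Δ
  contract-▹ k {F = F} {X} {Γ} lt s d =
    contract-list k X (λ H∈X → below (▹-weight s H∈X) lt) (_ , invert s (exchange (shift F X Γ) d))

  contract-boxed : ∀ {S} k {n} F Z {Γ Δ} → weight F < k →
                   Der≤ S n (Z ++ box⁻¹ (F ∷ F ∷ Γ)) Δ → Der S (Z ++ box⁻¹ (F ∷ Γ)) Δ
  contract-boxed k (var _)  Z lt d = _ , d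
  contract-boxed k ⊥'       Z lt d = _ , d
  contract-boxed k (_ ∧' _) Z lt d = _ , d
  contract-boxed k (_ ∨' _) Z lt d = _ , d
  contract-boxed k (_ ⇒' _) Z lt d = _ , d
  contract-boxed k (◇ _)    Z lt d = _ , d
  contract-boxed k (□ φ)    Z {Γ} lt d =
    exchangeᵈ (↭-sym (shift φ Z (box⁻¹ Γ)))
      (contract k (<-trans (weight-< (≺-□ {φ})) lt)
        (exchange (trans (shift φ Z (φ ∷ box⁻¹ Γ)) (prep φ (shift φ Z (box⁻¹ Γ)))) d))

  contract-L : ∀ {S} k {n F Γ G Γ₀ Δ} → weight F < k → F ∷ F ∷ Γ ↭ G ∷ Γ₀ →
               LeftRule (Der≤ S n) G Γ₀ Δ → Der S (F ∷ Γ) Δ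
  contract-L k lt σ r with ∷∷↭∷-inv σ
  contract-L (suc k) lt σ r | inj₁ (refl , ρ) = contract-principal k lt (LeftRule-exchange ρ r)
  contract-L k {F = F} {G = G} lt σ r | inj₂ (Γ₂ , ρ , ρ') = leftRule (trans (prep F ρ) (swap F G refl))
    (LeftRule-map (λ _ → ∈-contract ∘ ∈-resp-↭ ρ') (λ {Y} _ → contract-under Y) (contract-under [ _ ])
                  (λ {Z} → contract-boxed k F Z lt ∘ exchange (++⁺ˡ Z (box⁻¹-↭ ρ'))) r)
    where
    contract-under : ∀ {n} Y {Δ} → Der≤ _ n (Y ++ _) Δ → Der _ (Y ++ F ∷ Γ₂) Δ
    contract-under Y =
      exchangeᵈ (↭-sym (shift F Y Γ₂)) ∘ contract k lt ∘ exchange (trans (++⁺ˡ Y ρ') (shifts Y (F ∷ F ∷ [])))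

  contract-principal : ∀ {S} k {n F Γ Δ} → weight F < suc k → LeftRule (Der≤ S n) F (F ∷ Γ) Δ → Der S (F ∷ Γ) Δ
  contract-principal k lt (∧L d)   = leftRule refl (∧L (contract-▹ k lt ∧▹ d))
  contract-principal k lt (∨L d e) = leftRule refl (∨L (contract-▹ k lt ∨▹ˡ d) (contract-▹ k lt ∨▹ʳ e))
  contract-principal k lt (∧⇒L d)  = leftRule refl (∧⇒L (contract-▹ k lt ∧⇒▹ d))
  contract-principal k lt (∨⇒L d)  = leftRule refl (∨⇒L (contract-▹ k lt ∨⇒▹ d))
  contract-principal k lt (p⇒L p∈ d) = leftRule refl (p⇒L (∈-∷-▹ p⇒▹ tt p∈) (contract-▹ k lt p⇒▹ d))
  contract-principal k {F = F} {Γ} lt (⇒⇒L {φ} {ψ} {χ} d e) =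
    leftRule refl (⇒⇒L (⇒Rᵈ (contract-list k (φ ∷ (ψ ⇒' χ) ∷ []) bound
                                (⇒⇒-inv k lt (exchange (shift F (φ ∷ (ψ ⇒' χ) ∷ []) Γ) (⇒R-inv d)))))
                       (contract-▹ k lt ⇒⇒▹ e))
    where
    bound : ∀ {G} → G ∈ φ ∷ (ψ ⇒' χ) ∷ [] → weight G < k
    bound (here refl)         = below (≺-⇒⇒ˡ {φ} {ψ} {χ}) lt
    bound (there (here refl)) = below (≺-⇒⇒ {φ} {ψ} {χ}) lt
  contract-principal k lt (□⇒L d e) = leftRule refl (□⇒L (_ , d) (contract-▹ k lt □⇒▹ e))
  contract-principal k lt (◇⇒L ◇γ∈ d e) =
    leftRule refl (◇⇒L (∈-∷-▹ ◇⇒▹ tt ◇γ∈) (_ , d) (contract-▹ k lt ◇⇒▹ e))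

  ⇒⇒-inv : ∀ {S} k {n φ ψ χ Γ Δ} → weight ((φ ⇒' ψ) ⇒' χ) < suc k →
           Der≤ S n (((φ ⇒' ψ) ⇒' χ) ∷ Γ) Δ → Der S (φ ∷ (ψ ⇒' χ) ∷ Γ) Δ
  ⇒⇒-inv k lt (⊥L ⊥∈)  = 1 , ⊥L (there (there (∈-∷-▹ ⇒⇒▹ tt ⊥∈)))
  ⇒⇒-inv k lt (IdP p∈) = 1 , IdP (there (there (∈-∷-▹ ⇒⇒▹ tt p∈)))
  ⇒⇒-inv k lt (∧R d e) = ∧Rᵈ (⇒⇒-inv k lt d) (⇒⇒-inv k lt e)
  ⇒⇒-inv k lt (∨R₁ d)  = ∨R₁ᵈ (⇒⇒-inv k lt d)
  ⇒⇒-inv k lt (∨R₂ d)  = ∨R₂ᵈ (⇒⇒-inv k lt d)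
  ⇒⇒-inv k {φ = φ} {ψ} {χ} {Γ} lt (⇒R {φ = θ} d) =
    ⇒Rᵈ (exchangeᵈ (shift θ (φ ∷ (ψ ⇒' χ) ∷ []) Γ) (⇒⇒-inv k lt (exchange (swap _ _ refl) d)))
  ⇒⇒-inv k {φ = φ} {ψ} {χ} lt (□R d) = _ , □R (weaken-boxed (φ ∷ (ψ ⇒' χ) ∷ []) [] d)
  ⇒⇒-inv k {φ = φ} {ψ} {χ} lt (◇L ◇θ∈ ok d) =
    _ , ◇L (there (there (∈-∷-▹ ⇒⇒▹ tt ◇θ∈))) ok (weaken-boxed (φ ∷ (ψ ⇒' χ) ∷ []) [ _ ] d)
  ⇒⇒-inv k {φ = φ} {ψ} {χ} {Γ} lt (L σ r) with ∷↭∷-inv σ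
  ⇒⇒-inv k {φ = φ} {ψ} {χ} {Γ} lt (L σ (⇒⇒L d e)) | inj₁ (refl , ρ) =
    exchangeᵈ (swap (ψ ⇒' χ) φ refl)
      (modus-ponens k (below (≺-⇒⇒ {φ} {ψ} {χ}) lt) whole
        (exchange (trans (swap φ (ψ ⇒' χ) refl) (prep _ (prep φ (↭-sym ρ)))) (⇒R-inv d))
        (_ , exchange (trans (shifts ((ψ ⇒' χ) ∷ φ ∷ []) [ χ ]) (prep χ (prep _ (prep φ (↭-sym ρ)))))
                      (weakenˡ ((ψ ⇒' χ) ∷ φ ∷ []) e)))
  ... | inj₂ (Γ₁ , ρ₁ , ρ₂) =
    leftRule (trans (++⁺ˡ Ψ ρ₁) (shift _ Ψ Γ₁))
      (LeftRule-map (λ irr → ∈-++⁺ʳ Ψ ∘ ∈-∷-▹ ⇒⇒▹ irr ∘ ∈-resp-↭ ρ₂)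
        (λ {Y} _ → ⇒⇒-inv-under Y) (⇒⇒-inv-under [ _ ])
        (λ {Z} → _,_ _ ∘ weaken-boxed Ψ Z
                 ∘ exchange (trans (++⁺ˡ Z (box⁻¹-↭ ρ₂)) (↭-reflexive (cong (Z ++_) (box⁻¹-∷-▹ Γ₁ (⇒⇒▹ {φ} {ψ} {χ}))))))
        r)
    where
    Ψ : List Fm
    Ψ = φ ∷ (ψ ⇒' χ) ∷ []
    ⇒⇒-inv-under : ∀ {n} Y {Δ} → Der≤ _ n (Y ++ _) Δ → Der _ (Y ++ Ψ ++ Γ₁) Δ
    ⇒⇒-inv-under Y = exchangeᵈ (shifts Ψ Y) ∘ ⇒⇒-inv k lt ∘ exchange (trans (++⁺ˡ Y ρ₂) (shift _ Y Γ₁))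

  absorb : ∀ {S} k {A B Γ Δ} → weight (A ⇒' B) < suc k → A ⇒' B ▹ [ B ] →
           Der S (B ∷ (A ⇒' B) ∷ Γ) Δ → Der S (B ∷ Γ) Δ
  absorb k {A} {B} lt s = contractᵈ k (below (≺-⇒ʳ {A} {B}) lt) ∘ invertᵈ-tail s

  modus-ponens : ∀ {S} k {n A B Θ Γ Δ} → weight (A ⇒' B) < k → Residue A B Θ →
                 Der≤ S n (Θ ++ Γ) (just A) → Der S (B ∷ Θ ++ Γ) Δ → Der S (Θ ++ Γ) Δ
  modus-ponens (suc k) {A = A} {B} {Θ} lt (consequent st) d (_ , e) =
    contract-list k Θ (▹*-bound (λ { (here refl) → below (≺-⇒ʳ {A} {B}) lt }) st) (_ , invert* st e)
  modus-ponens (suc k) lt r (⊥L ⊥∈) E = 1 , ⊥L ⊥∈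
  modus-ponens (suc k) lt whole (IdP p∈) E = leftRule refl (p⇒L (∈-∷-▹ p⇒▹ tt p∈) (absorb k lt p⇒▹ E))
  modus-ponens (suc k) {A = A} lt whole (◇L ◇γ∈ ok d) E with dia-view A
  ... | is-◇ φ   = leftRule refl (◇⇒L (∈-∷-▹ ◇⇒▹ tt ◇γ∈) (_ , d) (absorb k lt ◇⇒▹ E))
  ... | not-◇ eq = ◇L-nonDia ◇γ∈ ok eq d
  modus-ponens (suc k) lt (curried r) (◇L ◇γ∈ ok d) E = ◇L-nonDia ◇γ∈ ok refl d
  modus-ponens (suc k) lt (split r₁ r₂ ρ) (◇L ◇γ∈ ok d) E = ◇L-nonDia ◇γ∈ ok refl d
  modus-ponens (suc k) lt whole (∧R d e) E =
    leftRule refl (∧⇒L (modus-ponens-∧ k lt whole (invert ∧⇒▹ d) (invert ∧⇒▹ e) (invertᵈ-tail ∧⇒▹ E)))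
  modus-ponens (suc k) lt (curried r) (∧R d e) E = modus-ponens-∧ k lt r d e E
  modus-ponens (suc k) {A = φ ∨' ψ} lt whole (∨R₁ d) E =
    leftRule refl (∨⇒L (modus-ponens-∨ˡ k {ψ = ψ} {Θ₂ = [ _ ]} lt whole refl (invert ∨⇒▹ d) (invertᵈ-tail ∨⇒▹ E)))
  modus-ponens (suc k) {A = φ ∨' ψ} lt whole (∨R₂ d) E =
    leftRule refl (∨⇒L (modus-ponens-∨ʳ k {φ = φ} {Θ₁ = [ _ ]} lt whole refl (invert ∨⇒▹ d) (invertᵈ-tail ∨⇒▹ E)))
  modus-ponens (suc k) {A = φ ∨' ψ} lt (split r₁ r₂ ρ) (∨R₁ d) E = modus-ponens-∨ˡ k {ψ = ψ} lt r₁ ρ d E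
  modus-ponens (suc k) {A = φ ∨' ψ} lt (split r₁ r₂ ρ) (∨R₂ d) E = modus-ponens-∨ʳ k {φ = φ} lt r₂ ρ d E
  modus-ponens (suc k) {A = φ ⇒' ψ} {B} {Γ = Γ} lt whole (⇒R d) E =
    leftRule refl (⇒⇒L (⇒Rᵈ (contractᵈ k (below (≺-⇒⇒ˡ {φ} {ψ} {B}) lt)
                                (exchangeᵈ (prep φ (swap (ψ ⇒' B) φ refl))
                                  (⇒⇒-inv k lt (exchange (swap φ _ refl) d)))))
                       (absorb k lt ⇒⇒▹ E))
  modus-ponens (suc k) lt whole (□R d) E = leftRule refl (□⇒L (_ , d) (absorb k lt □⇒▹ E))
  modus-ponens k lt r (L σ rule) E = modus-ponens-L k lt r σ rule E

  modus-ponens-∧ : ∀ {S} k {n φ ψ B Θ Γ Δ} → weight ((φ ∧' ψ) ⇒' B) < suc k → Residue φ (ψ ⇒' B) Θ →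
                   Der≤ S n (Θ ++ Γ) (just φ) → Der≤ S n (Θ ++ Γ) (just ψ) → Der S (B ∷ Θ ++ Γ) Δ → Der S (Θ ++ Γ) Δ
  modus-ponens-∧ k {φ = φ} {ψ} {B} {Θ} {Γ} lt r d e E =
    modus-ponens k (below (≺-curry {φ} {ψ} {B}) lt) r d
      (modus-ponens k {Γ = Θ ++ Γ} (below (≺-∧⇒ {φ} {ψ} {B}) lt) whole (weaken (ψ ⇒' B) e)
        (exchangeᵈ (swap (ψ ⇒' B) B refl) (weakenᵈ [ ψ ⇒' B ] E)))

  modus-ponens-∨ˡ : ∀ {S} k {n φ ψ B Θ Θ₁ Θ₂ Γ Δ} → weight ((φ ∨' ψ) ⇒' B) < suc k → Residue φ B Θ₁ →
                    Θ ↭ Θ₁ ++ Θ₂ → Der≤ S n (Θ ++ Γ) (just φ) → Der S (B ∷ Θ ++ Γ) Δ → Der S (Θ ++ Γ) Δ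
  modus-ponens-∨ˡ k {φ = φ} {ψ} {B} {Θ₁ = Θ₁} {Θ₂} {Γ} lt r ρ d E =
    exchangeᵈ (↭-sym ρ')
      (modus-ponens k {Γ = Θ₂ ++ Γ} (below (≺-∨⇒ˡ {φ} {ψ} {B}) lt) r (exchange ρ' d) (exchangeᵈ (prep B ρ') E))
    where
    ρ' : _ ++ Γ ↭ Θ₁ ++ Θ₂ ++ Γ
    ρ' = trans (++⁺ʳ Γ ρ) (↭-reflexive (++-assoc Θ₁ Θ₂ Γ))

  modus-ponens-∨ʳ : ∀ {S} k {n φ ψ B Θ Θ₁ Θ₂ Γ Δ} → weight ((φ ∨' ψ) ⇒' B) < suc k → Residue ψ B Θ₂ →
                    Θ ↭ Θ₁ ++ Θ₂ → Der≤ S n (Θ ++ Γ) (just ψ) → Der S (B ∷ Θ ++ Γ) Δ → Der S (Θ ++ Γ) Δ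
  modus-ponens-∨ʳ k {φ = φ} {ψ} {B} {Θ₁ = Θ₁} {Θ₂} {Γ} lt r ρ d E =
    exchangeᵈ (↭-sym ρ')
      (modus-ponens k {Γ = Θ₁ ++ Γ} (below (≺-∨⇒ʳ {φ} {ψ} {B}) lt) r (exchange ρ' d) (exchangeᵈ (prep B ρ') E))
    where
    ρ' : _ ++ Γ ↭ Θ₂ ++ Θ₁ ++ Γ
    ρ' = trans (++⁺ʳ Γ ρ) (trans (↭-reflexive (++-assoc Θ₁ Θ₂ Γ)) (shifts Θ₁ Θ₂))

  modus-ponens-L : ∀ {S} k {n A B Θ Γ H Γ₀ Δ} → weight (A ⇒' B) < k → Residue A B Θ → Θ ++ Γ ↭ H ∷ Γ₀ →
                   LeftRule (Der≤ S n) H Γ₀ (just A) → Der S (B ∷ Θ ++ Γ) Δ → Der S (Θ ++ Γ) Δ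
  modus-ponens-L k {B = B} {Θ} {Γ} {H} lt r σ rule E with ∈-++⁻ Θ (↭∷⇒∈ σ)
  ... | inj₁ H∈Θ with ∈⇒↭∷ H∈Θ
  ... | Θ₀ , ρΘ = leftRule σ (LeftRule-map (λ _ → id) premise (_,_ _) (_,_ _) rule)
    where
    premise : ∀ {Y} → H ▹ Y → Der≤ _ _ (Y ++ _) (just _) → Der _ (Y ++ _) _
    premise {Y} s d = exchangeᵈ (↭-sym ρ) (modus-ponens k lt (Residue-▹ r ρΘ s) (exchange ρ d) E')
      where
      ρ : Y ++ _ ↭ (Y ++ Θ₀) ++ Γ
      ρ = trans (++⁺ˡ Y (drop-∷ (trans (↭-sym σ) (++⁺ʳ Γ ρΘ)))) (↭-reflexive (sym (++-assoc Y Θ₀ Γ)))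
      E' : Der _ (B ∷ (Y ++ Θ₀) ++ Γ) _
      E' = exchangeᵈ (prep B (↭-reflexive (sym (++-assoc Y Θ₀ Γ)))) (invertᵈ-tail s (exchangeᵈ (prep B (++⁺ʳ Γ ρΘ)) E))
  modus-ponens-L k {B = B} {Θ} {Γ} {H} lt r σ rule E
    | inj₂ H∈Γ with ∈⇒↭∷ H∈Γ
  ... | Γ₁ , ρΓ = leftRule σ (LeftRule-map (λ _ → id) premise (_,_ _) (_,_ _) rule)
    where
    ρH : Θ ++ Γ ↭ H ∷ Θ ++ Γ₁
    ρH = trans (++⁺ˡ Θ ρΓ) (shift H Θ Γ₁)
    premise : ∀ {Y} → H ▹ Y → Der≤ _ _ (Y ++ _) (just _) → Der _ (Y ++ _) _
    premise {Y} s d = exchangeᵈ (↭-sym ρ) (modus-ponens k lt r (exchange ρ d) E')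
      where
      ρ : Y ++ _ ↭ Θ ++ Y ++ Γ₁
      ρ = trans (++⁺ˡ Y (drop-∷ (trans (↭-sym σ) ρH))) (shifts Y Θ)
      E' : Der _ (B ∷ Θ ++ Y ++ Γ₁) _
      E' = exchangeᵈ (prep B (shifts Y Θ)) (invertᵈ-tail s (exchangeᵈ (prep B ρH) E))

contraction : ∀ {S F Γ Δ} → Der S (F ∷ F ∷ Γ) Δ → Der S (F ∷ Γ) Δ
contraction {F = F} = contractᵈ (suc (weight F)) ≤-refl

∈-contraction : ∀ {S x Γ Δ} → x ∈ Γ → Der S (x ∷ Γ) Δ → Der S Γ Δ
∈-contraction x∈Γ d with ∈⇒↭∷ x∈Γ
... | _ , ρ = exchangeᵈ (↭-sym ρ) (contraction (exchangeᵈ (prep _ ρ) d))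

-- Cut

strengthen-⇒ : ∀ {S} φ {χ Γ Δ} → Der S ((φ ⇒' χ) ∷ Γ) Δ → Der S (χ ∷ Γ) Δ
strengthen-⇒ (var _)  = invertᵈ p⇒▹
strengthen-⇒ ⊥'       = invertᵈ ⊥⇒▹
strengthen-⇒ (φ ∧' ψ) = strengthen-⇒ ψ ∘ strengthen-⇒ φ ∘ invertᵈ ∧⇒▹
strengthen-⇒ (φ ∨' ψ) =
  contraction ∘ strengthen-⇒ ψ ∘ exchangeᵈ (swap _ _ refl) ∘ strengthen-⇒ φ ∘ invertᵈ ∨⇒▹
strengthen-⇒ (_ ⇒' _) = invertᵈ ⇒⇒▹
strengthen-⇒ (□ _)    = invertᵈ □⇒▹
strengthen-⇒ (◇ _)    = invertᵈ ◇⇒▹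

LeftRule-unboxed : ∀ {P H Γ Δ} → LeftRule P H Γ Δ → unbox H ≡ nothing
LeftRule-unboxed (∧L _)      = refl
LeftRule-unboxed (∨L _ _)    = refl
LeftRule-unboxed (∧⇒L _)     = refl
LeftRule-unboxed (∨⇒L _)     = refl
LeftRule-unboxed (p⇒L _ _)   = refl
LeftRule-unboxed (⇒⇒L _ _)   = refl
LeftRule-unboxed (□⇒L _ _)   = refl
LeftRule-unboxed (◇⇒L _ _ _) = refl

box⁻¹-↭-∷ : ∀ {H Γ Γ₁} → unbox H ≡ nothing → Γ ↭ H ∷ Γ₁ → box⁻¹ Γ ↭ box⁻¹ Γ₁
box⁻¹-↭-∷ {Γ₁ = Γ₁} eq ρ = trans (box⁻¹-↭ ρ) (↭-reflexive (box⁻¹-∷-unboxed Γ₁ eq))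

∈-other : ∀ {ψ φ H : Fm} {Γ₀ Γ₁ Γ} → Γ₀ ↭ φ ∷ Γ₁ → Γ ↭ H ∷ Γ₁ → ψ ∈ Γ₀ → ψ ≢ φ → ψ ∈ Γ
∈-other ρ₂ ρ₁ ψ∈ ψ≢φ with ∈-resp-↭ ρ₂ ψ∈
... | here ψ≡φ = ⊥-elim (ψ≢φ ψ≡φ)
... | there ψ∈Γ₁ = ∈-resp-↭ (↭-sym ρ₁) (there ψ∈Γ₁)

Witnessed : ∀ {P H Γ₀ Δ} → LeftRule P H Γ₀ Δ → List Fm → Set
Witnessed (p⇒L {p} _ _)       Γ = var p ∈ Γ
Witnessed (◇⇒L {γ = γ} _ _ _) Γ = ◇ γ ∈ Γ
Witnessed _                   Γ = ⊤

witnessed : ∀ {P H Γ₀ Δ φ Γ₁ Γ} (r : LeftRule P H Γ₀ Δ) → (∀ {p} → var p ≢ φ) → (∀ {γ} → ◇ γ ≢ φ) →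
            Γ₀ ↭ φ ∷ Γ₁ → Γ ↭ H ∷ Γ₁ → Witnessed r Γ
witnessed (∧L _)         _   _  _  _  = tt
witnessed (∨L _ _)       _   _  _  _  = tt
witnessed (∧⇒L _)        _   _  _  _  = tt
witnessed (∨⇒L _)        _   _  _  _  = tt
witnessed (p⇒L p∈ _)     p≢φ _  ρ₂ ρ₁ = ∈-other ρ₂ ρ₁ p∈ p≢φ
witnessed (⇒⇒L _ _)      _   _  _  _  = tt
witnessed (□⇒L _ _)      _   _  _  _  = tt
witnessed (◇⇒L ◇γ∈ _ _)  _ ◇≢φ ρ₂ ρ₁ = ∈-other ρ₂ ρ₁ ◇γ∈ ◇≢φ

leftRule-∈ : ∀ {S H Γ Γ₁ Δ} → Γ ↭ H ∷ Γ₁ → LeftRule (Der S) H Γ Δ → Der S Γ Δ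
leftRule-∈ ρ = ∈-contraction (↭∷⇒∈ ρ) ∘ leftRule refl

module _ {S n H Γ₀ Γ₁ φ Γ} (ρ₁ : Γ ↭ H ∷ Γ₁) (ρ₂ : Γ₀ ↭ φ ∷ Γ₁)
         (cut-φ : ∀ Y {F} → Der≤ S n (φ ∷ Y ++ Γ) F → Der S (Y ++ Γ) F) where

  cut-premise : ∀ Y {F} → Der≤ S n (Y ++ Γ₀) F → Der S (Y ++ Γ) F
  cut-premise Y = cut-φ Y ∘ exchange ρ ∘ weaken H
    where
    ρ : H ∷ Y ++ Γ₀ ↭ φ ∷ Y ++ Γ
    ρ = trans (prep H (trans (++⁺ˡ Y ρ₂) (shift φ Y Γ₁)))
              (trans (swap H φ refl) (prep φ (trans (↭-sym (shift H Y Γ₁)) (++⁺ˡ Y (↭-sym ρ₁)))))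

  -- The rule is re-applied with its principal formula H kept in the context, so that the left premise
  -- of the cut, whose context Γ contains H, fits every premise; H is contracted afterwards.
  cut-through : ∀ {Δ} (r : LeftRule (Der≤ S n) H Γ₀ Δ) → Witnessed r Γ →
                (∀ Z {F} → Der≤ S n (Z ++ box⁻¹ Γ₀) F → Der S (Z ++ box⁻¹ Γ) F) → Der S Γ Δ
  cut-through (∧L d)          _   _     = leftRule-∈ ρ₁ (∧L (cut-premise (_ ∷ _ ∷ []) d))
  cut-through (∨L d e)        _   _     = leftRule-∈ ρ₁ (∨L (cut-premise [ _ ] d) (cut-premise [ _ ] e))
  cut-through (∧⇒L d)         _   _     = leftRule-∈ ρ₁ (∧⇒L (cut-premise [ _ ] d))
  cut-through (∨⇒L d)         _   _     = leftRule-∈ ρ₁ (∨⇒L (cut-premise (_ ∷ _ ∷ []) d))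
  cut-through (p⇒L _ d)       p∈  _     = leftRule-∈ ρ₁ (p⇒L p∈ (cut-premise [ _ ] d))
  cut-through (⇒⇒L d e)       _   _     = leftRule-∈ ρ₁ (⇒⇒L (cut-premise [ _ ] d) (cut-premise [ _ ] e))
  cut-through (□⇒L d e)       _   modal = leftRule-∈ ρ₁ (□⇒L (modal [] d) (cut-premise [ _ ] e))
  cut-through (◇⇒L _ d e)     ◇γ∈ modal = leftRule-∈ ρ₁ (◇⇒L ◇γ∈ (modal [ _ ] d) (cut-premise [ _ ] e))

modal-unboxed : ∀ {S n H φ Γ₀ Γ₁ Γ} → unbox H ≡ nothing → unbox φ ≡ nothing → Γ ↭ H ∷ Γ₁ → Γ₀ ↭ φ ∷ Γ₁ →
                ∀ Z {F} → Der≤ S n (Z ++ box⁻¹ Γ₀) F → Der S (Z ++ box⁻¹ Γ) F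
modal-unboxed {Γ₁ = Γ₁} H-unboxed φ-unboxed ρ₁ ρ₂ Z d =
  _ , exchange (++⁺ˡ Z (trans (box⁻¹-↭-∷ φ-unboxed ρ₂) (↭-sym (box⁻¹-↭-∷ H-unboxed ρ₁)))) d

mutual
  cutᵈ : ∀ {S} k {Γ φ Δ} → weight φ < k → Der S Γ (just φ) → Der S (φ ∷ Γ) Δ → Der S Γ Δ
  cutᵈ k lt (_ , d) (_ , e) = cut k lt d e

  cut : ∀ {S} k {m n Γ φ Δ} → weight φ < k → Der≤ S m Γ (just φ) → Der≤ S n (φ ∷ Γ) Δ → Der S Γ Δ
  cut (suc k) lt (⊥L ⊥∈)  e = 1 , ⊥L ⊥∈
  cut (suc k) lt (IdP p∈) e = ∈-contraction p∈ (_ , e)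
  cut (suc k) {φ = φ ∧' ψ} lt (∧R d₁ d₂) e =
    cutᵈ k (below (≺-∧ˡ {φ} {ψ}) lt) (_ , d₁)
      (cut k (below (≺-∧ʳ {φ} {ψ}) lt) (weaken φ d₂) (exchange (swap φ ψ refl) (invert ∧▹ e)))
  cut (suc k) {φ = φ ∨' ψ} lt (∨R₁ d) e = cut k (below (≺-∨ˡ {φ} {ψ}) lt) d (invert ∨▹ˡ e)
  cut (suc k) {φ = φ ∨' ψ} lt (∨R₂ d) e = cut k (below (≺-∨ʳ {φ} {ψ}) lt) d (invert ∨▹ʳ e)
  cut (suc k) lt (⇒R d) e = cut-⇒ k lt d e
  cut (suc k) lt (□R d) e = cut-□ k lt d e
  cut (suc k) {φ = φ} lt (◇L ◇γ∈ ok d) e with dia-view φ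
  ... | is-◇ ψ   = cut-◇ k lt ◇γ∈ d e
  ... | not-◇ eq = ◇L-nonDia ◇γ∈ ok eq d
  cut (suc k) {φ = φ} lt (L {Γ = Γ₀} {G = H} σ r) e =
    leftRule σ (LeftRule-map (λ _ → id) (λ {Y} s d → cut (suc k) lt d (invert-side s)) (_,_ _) (_,_ _) r)
    where
    invert-side : ∀ {Y} → H ▹ Y → Der≤ _ _ (φ ∷ Y ++ Γ₀) _
    invert-side {Y} s = exchange (shift φ Y Γ₀) (invert s (exchange (trans (prep φ σ) (swap φ H refl)) e))

  cut-⇒ : ∀ {S} k {m n φ χ Γ Δ} → weight (φ ⇒' χ) < suc k →
          Der≤ S m (φ ∷ Γ) (just χ) → Der≤ S n ((φ ⇒' χ) ∷ Γ) Δ → Der S Γ Δ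
  cut-⇒ k lt d (⊥L (there ⊥∈))  = 1 , ⊥L ⊥∈
  cut-⇒ k lt d (IdP (there p∈)) = 1 , IdP p∈
  cut-⇒ k lt d (∧R e₁ e₂)       = ∧Rᵈ (cut-⇒ k lt d e₁) (cut-⇒ k lt d e₂)
  cut-⇒ k lt d (∨R₁ e)          = ∨R₁ᵈ (cut-⇒ k lt d e)
  cut-⇒ k lt d (∨R₂ e)          = ∨R₂ᵈ (cut-⇒ k lt d e)
  cut-⇒ k {φ = φ} lt d (⇒R {φ = θ} e) =
    ⇒Rᵈ (cut-⇒ k lt (exchange (swap θ φ refl) (weaken θ d)) (exchange (swap _ _ refl) e))
  cut-⇒ k lt d (□R e)                  = _ , □R e
  cut-⇒ k lt d (◇L (there ◇γ∈) ok e)   = _ , ◇L ◇γ∈ ok e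
  cut-⇒ k {φ = φ} {χ} {Γ} lt d (L σ r) with ∷↭∷-inv σ
  ... | inj₁ (refl , ρ) = cut-⇒-principal k lt d (LeftRule-exchange (↭-sym ρ) r)
  ... | inj₂ (Γ₁ , ρ₁ , ρ₂) =
    cut-through ρ₁ ρ₂ (λ Y → cut-⇒ k lt (weaken-under Y d)) r (witnessed r (λ ()) (λ ()) ρ₂ ρ₁)
                (modal-unboxed (LeftRule-unboxed r) refl ρ₁ ρ₂)

  cut-⇒-principal : ∀ {S} k {m n φ χ Γ Δ} → weight (φ ⇒' χ) < suc k →
                    Der≤ S m (φ ∷ Γ) (just χ) → LeftRule (Der≤ S n) (φ ⇒' χ) Γ Δ → Der S Γ Δ
  cut-⇒-principal k lt d (∧⇒L {φ} {ψ} {χ} e) =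
    cut k (below (≺-curry {φ} {ψ} {χ}) lt) (⇒R (⇒R (exchange (swap φ ψ refl) (invert ∧▹ d)))) e
  cut-⇒-principal k lt d (∨⇒L {φ} {ψ} {χ} e) =
    cutᵈ k (below (≺-∨⇒ʳ {φ} {ψ} {χ}) lt) (_ , ⇒R (invert ∨▹ʳ d))
      (cut k (below (≺-∨⇒ˡ {φ} {ψ} {χ}) lt) (weaken (ψ ⇒' χ) (⇒R (invert ∨▹ˡ d))) e)
  cut-⇒-principal k lt d (p⇒L {p} {χ} p∈ e) =
    cutᵈ k (below (≺-⇒ʳ {var p} {χ}) lt) (∈-contraction p∈ (_ , d)) (_ , e)
  cut-⇒-principal k lt d (⇒⇒L {φ} {ψ} {χ} e₁ e₂) =
    cutᵈ k (below (≺-⇒ʳ {φ ⇒' ψ} {χ}) lt)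
      (cutᵈ k (below (≺-⇒ˡ {φ ⇒' ψ} {χ}) lt)
        (cutᵈ k (below (≺-⇒⇒ {φ} {ψ} {χ}) lt) (⇒Rᵈ (strengthen-⇒ φ (_ , d))) (_ , e₁))
        (_ , d))
      (_ , e₂)
  cut-⇒-principal k lt d (□⇒L {φ} {χ} e₁ e₂) =
    cutᵈ k (below (≺-⇒ʳ {□ φ} {χ}) lt) (cut k (below (≺-⇒ˡ {□ φ} {χ}) lt) (□R e₁) d) (_ , e₂)
  cut-⇒-principal k lt d (◇⇒L {φ} {γ} {χ} ◇γ∈ e₁ e₂) =
    cutᵈ k (below (≺-⇒ʳ {◇ φ} {χ}) lt) (cut k (below (≺-⇒ˡ {◇ φ} {χ}) lt) (◇L ◇γ∈ ◇-succedent e₁) d) (_ , e₂)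

  cut-□ : ∀ {S} k {m n φ Γ Δ} → weight (□ φ) < suc k →
          Der≤ S m (box⁻¹ Γ) (just φ) → Der≤ S n (□ φ ∷ Γ) Δ → Der S Γ Δ
  cut-□ k lt d (⊥L (there ⊥∈))  = 1 , ⊥L ⊥∈
  cut-□ k lt d (IdP (there p∈)) = 1 , IdP p∈
  cut-□ k lt d (∧R e₁ e₂)       = ∧Rᵈ (cut-□ k lt d e₁) (cut-□ k lt d e₂)
  cut-□ k lt d (∨R₁ e)          = ∨R₁ᵈ (cut-□ k lt d e)
  cut-□ k lt d (∨R₂ e)          = ∨R₂ᵈ (cut-□ k lt d e)
  cut-□ k lt d (⇒R {φ = θ} e)   = ⇒Rᵈ (cut-□ k lt (weaken-boxed [ θ ] [] d) (exchange (swap _ _ refl) e))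
  cut-□ k {φ = φ} lt d (□R e)   = □Rᵈ (cut k (below (≺-□ {φ}) lt) d e)
  cut-□ k {φ = φ} lt d (◇L {φ = θ} (there ◇θ∈) ok e) =
    ◇Lᵈ ◇θ∈ ok (cut k (below (≺-□ {φ}) lt) (weaken θ d) (exchange (swap θ φ refl) e))
  cut-□ k lt d (L σ r) with ∷↭∷-inv σ
  cut-□ k lt d (L σ ()) | inj₁ (refl , _)
  cut-□ k {φ = φ} {Γ} lt d (L {Γ = Γ₀} σ r) | inj₂ (Γ₁ , ρ₁ , ρ₂) =
    cut-through ρ₁ ρ₂ (λ Y → cut-□ k lt (weaken-boxed Y [] d)) r (witnessed r (λ ()) (λ ()) ρ₂ ρ₁) modal
    where
    ρ : box⁻¹ Γ ↭ box⁻¹ Γ₁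
    ρ = box⁻¹-↭-∷ (LeftRule-unboxed r) ρ₁
    modal : ∀ Z {F} → Der≤ _ _ (Z ++ box⁻¹ Γ₀) F → Der _ (Z ++ box⁻¹ Γ) F
    modal Z e = exchangeᵈ (++⁺ˡ Z (↭-sym ρ))
      (cut k (below (≺-□ {φ}) lt) (weakenˡ Z (exchange ρ d))
        (exchange (trans (++⁺ˡ Z (box⁻¹-↭ ρ₂)) (shift φ Z (box⁻¹ Γ₁))) e))

  cut-◇ : ∀ {S} k {m n ψ γ Γ Δ} → weight (◇ ψ) < suc k → ◇ γ ∈ Γ →
          Der≤ S m (γ ∷ box⁻¹ Γ) (just ψ) → Der≤ S n (◇ ψ ∷ Γ) Δ → Der S Γ Δ
  cut-◇ k lt ◇γ∈ d (⊥L (there ⊥∈))  = 1 , ⊥L ⊥∈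
  cut-◇ k lt ◇γ∈ d (IdP (there p∈)) = 1 , IdP p∈
  cut-◇ k lt ◇γ∈ d (∧R e₁ e₂)       = ∧Rᵈ (cut-◇ k lt ◇γ∈ d e₁) (cut-◇ k lt ◇γ∈ d e₂)
  cut-◇ k lt ◇γ∈ d (∨R₁ e)          = ∨R₁ᵈ (cut-◇ k lt ◇γ∈ d e)
  cut-◇ k lt ◇γ∈ d (∨R₂ e)          = ∨R₂ᵈ (cut-◇ k lt ◇γ∈ d e)
  cut-◇ k lt ◇γ∈ d (⇒R {φ = θ} e)   =
    ⇒Rᵈ (cut-◇ k lt (there ◇γ∈) (weaken-boxed [ θ ] [ _ ] d) (exchange (swap _ _ refl) e))
  cut-◇ k lt ◇γ∈ d (□R e)           = _ , □R e
  cut-◇ k {ψ = ψ} {γ} lt ◇γ∈ d (◇L (here refl) ok e) =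
    ◇Lᵈ ◇γ∈ ok (cut k (below (≺-◇ {ψ}) lt) d (exchange (swap γ ψ refl) (weaken γ e)))
  cut-◇ k lt ◇γ∈ d (◇L (there ◇θ∈) ok e) = _ , ◇L ◇θ∈ ok e
  cut-◇ k lt ◇γ∈ d (L σ r) with ∷↭∷-inv σ
  cut-◇ k lt ◇γ∈ d (L σ ()) | inj₁ (refl , _)
  cut-◇ k lt ◇γ∈ d (L σ r) | inj₂ (_ , ρ₁ , ρ₂) = cut-◇-L k lt ◇γ∈ d r ρ₁ ρ₂

  cut-◇-L : ∀ {S} k {m n ψ γ Γ H Γ₀ Γ₁ Δ} → weight (◇ ψ) < suc k → ◇ γ ∈ Γ → Der≤ S m (γ ∷ box⁻¹ Γ) (just ψ) →
            LeftRule (Der≤ S n) H Γ₀ Δ → Γ ↭ H ∷ Γ₁ → Γ₀ ↭ ◇ ψ ∷ Γ₁ → Der S Γ Δ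
  cut-◇-L k {ψ = ψ} {γ} {Γ} {Γ₁ = Γ₁} lt ◇γ∈ d (◇⇒L {χ = χ} ◇θ∈ e₁ e₂) ρ₁ ρ₂ with ∈-resp-↭ ρ₂ ◇θ∈
  ... | here refl =
    leftRule ρ₁ (◇⇒L ◇γ∈Γ₁
      (cut k (below (≺-◇ {ψ}) lt) d₁ (exchange (swap γ ψ refl) (weaken γ (exchange (prep ψ (box⁻¹-↭ ρ₂)) e₁))))
      (cut-◇ k lt (there ◇γ∈Γ₁) (weaken-boxed [ χ ] [ γ ] d₁) (exchange (trans (prep χ ρ₂) (swap χ (◇ ψ) refl)) e₂)))
    where
    d₁ : Der≤ _ _ (γ ∷ box⁻¹ Γ₁) (just ψ)
    d₁ = exchange (prep γ (box⁻¹-↭-∷ refl ρ₁)) d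
    ◇γ∈Γ₁ : ◇ γ ∈ Γ₁
    ◇γ∈Γ₁ with ∈-resp-↭ ρ₁ ◇γ∈
    ... | there ◇γ∈Γ₁ = ◇γ∈Γ₁
  ... | there ◇θ∈Γ₁ = cut-◇-through k lt ◇γ∈ d (◇⇒L ◇θ∈ e₁ e₂) (∈-resp-↭ (↭-sym ρ₁) (there ◇θ∈Γ₁)) ρ₁ ρ₂
  cut-◇-L k lt ◇γ∈ d r@(p⇒L p∈ _) ρ₁ ρ₂ = cut-◇-through k lt ◇γ∈ d r (∈-other ρ₂ ρ₁ p∈ (λ ())) ρ₁ ρ₂
  cut-◇-L k lt ◇γ∈ d r@(∧L _)     ρ₁ ρ₂ = cut-◇-through k lt ◇γ∈ d r tt ρ₁ ρ₂
  cut-◇-L k lt ◇γ∈ d r@(∨L _ _)   ρ₁ ρ₂ = cut-◇-through k lt ◇γ∈ d r tt ρ₁ ρ₂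
  cut-◇-L k lt ◇γ∈ d r@(∧⇒L _)    ρ₁ ρ₂ = cut-◇-through k lt ◇γ∈ d r tt ρ₁ ρ₂
  cut-◇-L k lt ◇γ∈ d r@(∨⇒L _)    ρ₁ ρ₂ = cut-◇-through k lt ◇γ∈ d r tt ρ₁ ρ₂
  cut-◇-L k lt ◇γ∈ d r@(⇒⇒L _ _)  ρ₁ ρ₂ = cut-◇-through k lt ◇γ∈ d r tt ρ₁ ρ₂
  cut-◇-L k lt ◇γ∈ d r@(□⇒L _ _)  ρ₁ ρ₂ = cut-◇-through k lt ◇γ∈ d r tt ρ₁ ρ₂

  cut-◇-through : ∀ {S} k {m n ψ γ Γ H Γ₀ Γ₁ Δ} → weight (◇ ψ) < suc k → ◇ γ ∈ Γ → Der≤ S m (γ ∷ box⁻¹ Γ) (just ψ) →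
                  (r : LeftRule (Der≤ S n) H Γ₀ Δ) → Witnessed r Γ → Γ ↭ H ∷ Γ₁ → Γ₀ ↭ ◇ ψ ∷ Γ₁ → Der S Γ Δ
  cut-◇-through k lt ◇γ∈ d r w ρ₁ ρ₂ =
    cut-through ρ₁ ρ₂ (λ Y → cut-◇ k lt (∈-++⁺ʳ Y ◇γ∈) (weaken-boxed Y [ _ ] d)) r w
                (modal-unboxed (LeftRule-unboxed r) refl ρ₁ ρ₂)

cut-admissible : ∀ {S Γ φ Δ} → Der S Γ (just φ) → Der S (φ ∷ Γ) Δ → Der S Γ Δ
cut-admissible {φ = φ} = cutᵈ (suc (weight φ)) ≤-refl

G4CK→Der : ∀ {Γ φ} → G4CK Γ φ → Der CK Γ (just φ)
G4CK→Der (⊥L ρ)        = 1 , ⊥L (↭∷⇒∈ ρ)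
G4CK→Der (IdP ρ)       = 1 , IdP (↭∷⇒∈ ρ)
G4CK→Der (∧L ρ d)      = leftRule ρ (∧L (G4CK→Der d))
G4CK→Der (∧R d e)      = ∧Rᵈ (G4CK→Der d) (G4CK→Der e)
G4CK→Der (∨L ρ d e)    = leftRule ρ (∨L (G4CK→Der d) (G4CK→Der e))
G4CK→Der (∨R₁ d)       = ∨R₁ᵈ (G4CK→Der d)
G4CK→Der (∨R₂ d)       = ∨R₂ᵈ (G4CK→Der d)
G4CK→Der (⇒R d)        = ⇒Rᵈ (G4CK→Der d)
G4CK→Der (∧⇒L ρ d)     = leftRule ρ (∧⇒L (G4CK→Der d))
G4CK→Der (∨⇒L ρ d)     = leftRule ρ (∨⇒L (G4CK→Der d))
G4CK→Der (p⇒L ρ d)     = leftRule (trans ρ (swap _ _ refl)) (p⇒L (here refl) (exchangeᵈ (swap _ _ refl) (G4CK→Der d)))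
G4CK→Der (⇒⇒L ρ d e)   = leftRule ρ (⇒⇒L (G4CK→Der d) (G4CK→Der e))
G4CK→Der (□R d)        = □Rᵈ (G4CK→Der d)
G4CK→Der (□⇒L ρ d e)   = leftRule ρ (□⇒L (G4CK→Der d) (G4CK→Der e))
G4CK→Der (◇⇒L ρ d e)   =
  leftRule (trans ρ (swap _ _ refl)) (◇⇒L (here refl) (G4CK→Der d) (exchangeᵈ (swap _ _ refl) (G4CK→Der e)))
G4CK→Der (◇L {φ = φ} ρ d) = ◇Lᵈ (↭∷⇒∈ ρ) ◇-succedent (exchangeᵈ (prep φ (box⁻¹-↭ (↭-sym ρ))) (G4CK→Der d))

G4WK→Der : ∀ {Γ Δ} → G4WK Γ Δ → Der WK Γ Δ
G4WK→Der (⊥L ρ)        = 1 , ⊥L (↭∷⇒∈ ρ)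
G4WK→Der (IdP ρ)       = 1 , IdP (↭∷⇒∈ ρ)
G4WK→Der (∧L ρ d)      = leftRule ρ (∧L (G4WK→Der d))
G4WK→Der (∧R d e)      = ∧Rᵈ (G4WK→Der d) (G4WK→Der e)
G4WK→Der (∨L ρ d e)    = leftRule ρ (∨L (G4WK→Der d) (G4WK→Der e))
G4WK→Der (∨R₁ d)       = ∨R₁ᵈ (G4WK→Der d)
G4WK→Der (∨R₂ d)       = ∨R₂ᵈ (G4WK→Der d)
G4WK→Der (⇒R d)        = ⇒Rᵈ (G4WK→Der d)
G4WK→Der (∧⇒L ρ d)     = leftRule ρ (∧⇒L (G4WK→Der d))
G4WK→Der (∨⇒L ρ d)     = leftRule ρ (∨⇒L (G4WK→Der d))
G4WK→Der (p⇒L ρ d)     = leftRule (trans ρ (swap _ _ refl)) (p⇒L (here refl) (exchangeᵈ (swap _ _ refl) (G4WK→Der d)))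
G4WK→Der (⇒⇒L ρ d e)   = leftRule ρ (⇒⇒L (G4WK→Der d) (G4WK→Der e))
G4WK→Der (□R d)        = □Rᵈ (G4WK→Der d)
G4WK→Der (□⇒L ρ d e)   = leftRule ρ (□⇒L (G4WK→Der d) (G4WK→Der e))
G4WK→Der (◇⇒L ρ d e)   =
  leftRule (trans ρ (swap _ _ refl)) (◇⇒L (here refl) (G4WK→Der d) (exchangeᵈ (swap _ _ refl) (G4WK→Der e)))
G4WK→Der (◇L' {φ = φ} ρ d) = ◇Lᵈ (↭∷⇒∈ ρ) any-succedent (exchangeᵈ (prep φ (box⁻¹-↭ (↭-sym ρ))) (G4WK→Der d))

Der≤→G4CK : ∀ {n Γ φ} → Der≤ CK n Γ (just φ) → G4CK Γ φ
Der≤→G4CK (⊥L ⊥∈)   = ⊥L (proj₂ (∈⇒↭∷ ⊥∈))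
Der≤→G4CK (IdP p∈)  = IdP (proj₂ (∈⇒↭∷ p∈))
Der≤→G4CK (∧R d e)  = ∧R (Der≤→G4CK d) (Der≤→G4CK e)
Der≤→G4CK (∨R₁ d)   = ∨R₁ (Der≤→G4CK d)
Der≤→G4CK (∨R₂ d)   = ∨R₂ (Der≤→G4CK d)
Der≤→G4CK (⇒R d)    = ⇒R (Der≤→G4CK d)
Der≤→G4CK (□R d)    = □R (Der≤→G4CK d)
Der≤→G4CK (◇L {φ = φ} ◇φ∈ ◇-succedent d) with ∈⇒↭∷ ◇φ∈
... | _ , ρ = ◇L ρ (Der≤→G4CK (exchange (prep φ (box⁻¹-↭ ρ)) d))
Der≤→G4CK (L σ (∧L d))      = ∧L σ (Der≤→G4CK d)
Der≤→G4CK (L σ (∨L d e))    = ∨L σ (Der≤→G4CK d) (Der≤→G4CK e)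
Der≤→G4CK (L σ (∧⇒L d))     = ∧⇒L σ (Der≤→G4CK d)
Der≤→G4CK (L σ (∨⇒L d))     = ∨⇒L σ (Der≤→G4CK d)
Der≤→G4CK (L σ (p⇒L {χ = χ} p∈ d)) with ∈⇒↭∷ p∈
... | _ , ρ = p⇒L (trans σ (trans (prep _ ρ) (swap _ _ refl)))
                 (Der≤→G4CK (exchange (trans (prep χ ρ) (swap _ _ refl)) d))
Der≤→G4CK (L σ (⇒⇒L d e))   = ⇒⇒L σ (Der≤→G4CK d) (Der≤→G4CK e)
Der≤→G4CK (L σ (□⇒L d e))   = □⇒L σ (Der≤→G4CK d) (Der≤→G4CK e)
Der≤→G4CK (L σ (◇⇒L {γ = γ} {χ} ◇γ∈ d e)) with ∈⇒↭∷ ◇γ∈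
... | _ , ρ = ◇⇒L (trans σ (trans (prep _ ρ) (swap _ _ refl)))
                 (Der≤→G4CK (exchange (prep γ (box⁻¹-↭ ρ)) d))
                 (Der≤→G4CK (exchange (trans (prep χ ρ) (swap _ _ refl)) e))

Der≤→G4WK : ∀ {n Γ Δ} → Der≤ WK n Γ Δ → G4WK Γ Δ
Der≤→G4WK (⊥L ⊥∈)   = ⊥L (proj₂ (∈⇒↭∷ ⊥∈))
Der≤→G4WK (IdP p∈)  = IdP (proj₂ (∈⇒↭∷ p∈))
Der≤→G4WK (∧R d e)  = ∧R (Der≤→G4WK d) (Der≤→G4WK e)
Der≤→G4WK (∨R₁ d)   = ∨R₁ (Der≤→G4WK d)
Der≤→G4WK (∨R₂ d)   = ∨R₂ (Der≤→G4WK d)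
Der≤→G4WK (⇒R d)    = ⇒R (Der≤→G4WK d)
Der≤→G4WK (□R d)    = □R (Der≤→G4WK d)
Der≤→G4WK (◇L {φ = φ} ◇φ∈ _ d) with ∈⇒↭∷ ◇φ∈
... | _ , ρ = ◇L' ρ (Der≤→G4WK (exchange (prep φ (box⁻¹-↭ ρ)) d))
Der≤→G4WK (L σ (∧L d))      = ∧L σ (Der≤→G4WK d)
Der≤→G4WK (L σ (∨L d e))    = ∨L σ (Der≤→G4WK d) (Der≤→G4WK e)
Der≤→G4WK (L σ (∧⇒L d))     = ∧⇒L σ (Der≤→G4WK d)
Der≤→G4WK (L σ (∨⇒L d))     = ∨⇒L σ (Der≤→G4WK d)
Der≤→G4WK (L σ (p⇒L {χ = χ} p∈ d)) with ∈⇒↭∷ p∈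
... | _ , ρ = p⇒L (trans σ (trans (prep _ ρ) (swap _ _ refl)))
                 (Der≤→G4WK (exchange (trans (prep χ ρ) (swap _ _ refl)) d))
Der≤→G4WK (L σ (⇒⇒L d e))   = ⇒⇒L σ (Der≤→G4WK d) (Der≤→G4WK e)
Der≤→G4WK (L σ (□⇒L d e))   = □⇒L σ (Der≤→G4WK d) (Der≤→G4WK e)
Der≤→G4WK (L σ (◇⇒L {γ = γ} {χ} ◇γ∈ d e)) with ∈⇒↭∷ ◇γ∈
... | _ , ρ = ◇⇒L (trans σ (trans (prep _ ρ) (swap _ _ refl)))
                 (Der≤→G4WK (exchange (prep γ (box⁻¹-↭ ρ)) d))
                 (Der≤→G4WK (exchange (trans (prep χ ρ) (swap _ _ refl)) e))

theorem1 : ((Γ : List Fm) (φ Δ : Fm) → G4CK Γ φ → G4CK (φ ∷ Γ) Δ → G4CK Γ Δ)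
    × ((Γ : List Fm) (φ : Fm) (Δ : Maybe Fm) → G4WK Γ (just φ) → G4WK (φ ∷ Γ) Δ → G4WK Γ Δ)
theorem1 = (λ Γ φ Δ d e → Der≤→G4CK (proj₂ (cut-admissible (G4CK→Der d) (G4CK→Der e))))
         , (λ Γ φ Δ d e → Der≤→G4WK (proj₂ (cut-admissible (G4WK→Der d) (G4WK→Der e))))
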